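{- Consider a protocol in normal form with $n$ queries per party and the attacker Eve with parameter $\varepsilon\in(0,1/10)$ described in the context. Fix $(M,\mathcal{I})$, Eve's information just before the $i$-th round, with $\Pr_{\mathcal{EXEC}(M,\mathcal{I})}[\mathsf{Good}(M,\mathcal{I})]>0$, and let $\mathcal{A},\mathcal{B}$ be distributions over Alice's and Bob's views with $\mathcal{GEXEC}(M,\mathcal{I})=(\mathcal{A}\times\mathcal{B})\mid\mathsf{Good}(M,\mathcal{I})$. Form the bipartite graph $G=(V_L,V_R,E)$ whose left vertices are copies of Alice's views in the support of $\mathcal{A}$, each view $A$ having a number of copies proportional to $\Pr_{\mathcal{A}}[A]$ (so $\mathcal{A}$ is uniform on $V_L$), and similarly $V_R$ for $\mathcal{B}$; for $u\in V_L$ let $Q_u=Q(A_u)\setminus Q(\mathcal{I})$, for $v\in V_R$ let $Q_v=Q(B_v)\setminus Q(\mathcal{I})$, and put an edge between $u$ and $v$ iff $Q_u\cap Q_v=\emptyset$. Then every $u\in V_L$ has degree at least $(1-2\varepsilon)|V_R|$ and every $v\in V_R$ has degree at least $(1-2\varepsilon)|V_L|$.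
   Context: Setting: $H:\{0,1\}^{\ell}\to\{0,1\}^{\ell}$ is a uniformly random oracle. Alice and Bob have private random tapes $r_a,r_b$ and run a protocol with oracle access to $H$; in odd rounds Alice queries and sends a message, in even rounds Bob does; no party asks the same query twice. Normal form: in each round the acting party makes exactly one oracle query, so there are $2n$ rounds and each party makes $n$ queries. Eve sees all messages and may query $H$; after each message she performs her queries. An execution is a tuple $(r_a,h_a,r_b,h_b,\mathcal{I})$ where $h_a$ ($h_b$) is the sequence of oracle answers received by Alice (Bob) and $\mathcal{I}$ is the set of query/answer pairs learned by Eve; $\mathcal{EXEC}$ is the distribution of executions obtained with uniformly random tapes and a random oracle. For a message transcript $M$ so far and Eve's query/answer set $\mathcal{I}$, $\mathcal{EXEC}(M,\mathcal{I})$ is the distribution of partial executions (up to the point the last message of $M$ is sent) conditioned on the transcript being $M$ and Eve's set being $\mathcal{I}$. For Alice's view $A$ let $Q(A)$ be her set of queries, similarly $Q(B)$ for Bob, and $Q(\mathcal{I})$ the queries in $\mathcal{I}$. $\mathsf{Good}(M,\mathcal{I})$ is the event $Q(A)\cap Q(B)\subseteq Q(\mathcal{I})$, and $\mathcal{GEXEC}(M,\mathcal{I})$ is $\mathcal{EXEC}(M,\mathcal{I})$ conditioned on $\mathsf{Good}(M,\mathcal{I})$ (viewed as a distribution over pairs of views of Alice and Bob). Such $\mathcal{A},\mathcal{B}$ always exist when $\Pr[\mathsf{Good}(M,\mathcal{I})]>0$, and then a uniformly random edge $(u,v)$ of $G$ yields $(A_u,B_v)$ distributed as $\mathcal{GEXEC}(M,\mathcal{I})$.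 Eve's attack with parameter $\varepsilon$: at any point, with current $(M,\mathcal{I})$, for each $q$ let $p_q$ be the probability that $q$ is queried (by Alice or Bob) in a random execution from $\mathcal{GEXEC}(M,\mathcal{I})$; while some $p_q>\varepsilon/n$, Eve queries the lexicographically first such $q$ and adds it with its answer to $\mathcal{I}$; otherwise she waits for the next message. "Just before the $i$-th round" means after Eve has finished her queries following the previous message. -}

module Defs where

open import Data.Bool using (Bool; true; false; _∧_; _∨_; not; if_then_else_)
open import Data.Nat using (ℕ; zero; suc; _≡ᵇ_; ⌊_/2⌋; ⌈_/2⌉; _^_)
open import Data.List using (List; []; _∷_; _++_; map; concatMap; take; length; foldr)
open import Data.Vec using (Vec; []; _∷_)
open import Data.Product using (_×_; _,_; proj₁; proj₂)
open import Data.Integer using (+_)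
open import Data.Rational using (ℚ; 0ℚ; _+_; _*_; _<_; _/_)
open import Data.Rational.Properties using (_<?_)
open import Relation.Nullary.Decidable using (⌊_⌋)
open import Data.List.Relation.Unary.Unique.Propositional using (Unique)

Bits : ℕ → Set
Bits k = Vec Bool k

eqB : Bool → Bool → Bool
eqB true  true  = true
eqB false false = true
eqB _     _     = false

eqBits : {k : ℕ} → Bits k → Bits k → Bool
eqBits []       []       = true
eqBits (x ∷ xs) (y ∷ ys) = eqB x y ∧ eqBits xs ys

eqList : {A : Set} → (A → A → Bool) → List A → List A → Bool
eqList eq []       []       = true
eqList eq (x ∷ xs) (y ∷ ys) = eq x y ∧ eqList eq xs ys
eqList eq _        _        = false

anyB : {A : Set} → (A → Bool) → List A → Bool
anyB p []       = false
anyB p (x ∷ xs) = p x ∨ anyB p xs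

allB : {A : Set} → (A → Bool) → List A → Bool
allB p []       = true
allB p (x ∷ xs) = p x ∧ allB p xs

elem : {A : Set} → (A → A → Bool) → A → List A → Bool
elem eq x xs = anyB (eq x) xs

allBits : (k : ℕ) → List (Bits k)
allBits zero    = [] ∷ []
allBits (suc k) = map (false ∷_) (allBits k) ++ map (true ∷_) (allBits k)

allFuns : {B : Set} → (k : ℕ) → List B → List (Bits k → B)
allFuns zero    bs = map (λ b _ → b) bs
allFuns (suc k) bs =
  concatMap (λ f → map (λ g → λ { (false ∷ v) → f v ; (true ∷ v) → g v })
                       (allFuns k bs))
            (allFuns k bs)

allLists : {A : Set} → List A → ℕ → List (List A)
allLists xs zero    = [] ∷ []
allLists xs (suc n) = concatMap (λ x → map (x ∷_) (allLists xs n)) xs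

count : {A : Set} → (A → Bool) → List A → ℕ
count p []       = 0
count p (x ∷ xs) = if p x then suc (count p xs) else count p xs

sumℚ : {A : Set} → (A → ℚ) → List A → ℚ
sumℚ f xs = foldr (λ x acc → f x + acc) 0ℚ xs

sumℕ : {A : Set} → (A → ℕ) → List A → ℕ
sumℕ f xs = foldr (λ x acc → f x Data.Nat.+ acc) 0 xs

ℕtoℚ : ℕ → ℚ
ℕtoℚ k = (+ k) / 1

-- Alice acts in odd rounds, Bob in even rounds;
-- each acting party makes exactly one query, then sends one message.
-- Histories are given as lists (only lists of the right length are ever fed).
--   qA ra ansA msgsA msgsB : Alice's next query
--   mA ra ansA' msgsA msgsB : Alice's message (ansA' includes the fresh answer)

record Protocol (ℓ tA tB mlen : ℕ) : Set where
  field
    qA : Bits tA → List (Bits ℓ) → List (Bits mlen) → List (Bits mlen) → Bits ℓ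
    mA : Bits tA → List (Bits ℓ) → List (Bits mlen) → List (Bits mlen) → Bits mlen
    qB : Bits tB → List (Bits ℓ) → List (Bits mlen) → List (Bits mlen) → Bits ℓ
    mB : Bits tB → List (Bits ℓ) → List (Bits mlen) → List (Bits mlen) → Bits mlen

module Model {ℓ tA tB mlen : ℕ} (P : Protocol ℓ tA tB mlen) where
  open Protocol P

  Query : Set
  Query = Bits ℓ

  Msg : Set
  Msg = Bits mlen

  Oracle : Set
  Oracle = Query → Query

  -- sample space: (r_a , r_b , H), uniform
  Ω : Set
  Ω = Bits tA × Bits tB × Oracle

  allΩ : List Ω
  allΩ = concatMap (λ ra → concatMap (λ rb → map (λ H → ra , rb , H)
                     (allFuns ℓ (allBits ℓ))) (allBits tB)) (allBits tA)

  -- transcript: (Alice's messages , Bob's messages); determines the interleaving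
  Transcript : Set
  Transcript = List Msg × List Msg

  eqTr : Transcript → Transcript → Bool
  eqTr (a , b) (a' , b') = eqList eqBits a a' ∧ eqList eqBits b b'

  Info : Set
  Info = List (Query × Query)

  QI : Info → List Query
  QI I = map proj₁ I

  -- views: (tape , sequence of oracle answers received)
  ViewA : Set
  ViewA = Bits tA × List Query

  ViewB : Set
  ViewB = Bits tB × List Query

  eqViewA : ViewA → ViewA → Bool
  eqViewA (r , h) (r' , h') = eqBits r r' ∧ eqList eqBits h h'

  eqViewB : ViewB → ViewB → Bool
  eqViewB (r , h) (r' , h') = eqBits r r' ∧ eqList eqBits h h'

  -- all possible views after k messages (Alice answered ⌈k/2⌉, Bob ⌊k/2⌋ queries)
  viewsA : ℕ → List ViewA
  viewsA k = concatMap (λ r → map (r ,_) (allLists (allBits ℓ) ⌈ k /2⌉)) (allBits tA)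

  viewsB : ℕ → List ViewB
  viewsB k = concatMap (λ r → map (r ,_) (allLists (allBits ℓ) ⌊ k /2⌋)) (allBits tB)

  record State : Set where
    constructor st
    field
      ansA ansB : List Query
      msA msB   : List Msg

  step : Ω → State → State
  step (ra , rb , H) (st hA hB ma mb) =
    if length ma ≡ᵇ length mb
    then (let q = qA ra hA ma mb
              a = H q
          in st (hA ++ a ∷ []) hB (ma ++ mA ra (hA ++ a ∷ []) ma mb ∷ []) mb)
    else (let q = qB rb hB ma mb
              a = H q
          in st hA (hB ++ a ∷ []) ma (mb ++ mB rb (hB ++ a ∷ []) ma mb ∷ []))

  run : ℕ → Ω → State
  run zero    ω = st [] [] [] []
  run (suc k) ω = step ω (run k ω)

  transcript : ℕ → Ω → Transcript
  transcript k ω = State.msA (run k ω) , State.msB (run k ω)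

  viewA : ℕ → Ω → ViewA
  viewA k ω@(ra , _ , _) = ra , State.ansA (run k ω)

  viewB : ℕ → Ω → ViewB
  viewB k ω@(_ , rb , _) = rb , State.ansB (run k ω)

  -- Q(A): Alice's queries during her first i rounds, recomputed from her view
  -- and the transcript (returns queries and her own messages)
  aliceUpTo : Bits tA → List Query → List Msg → ℕ → List Query × List Msg
  aliceUpTo ra h mb zero    = [] , []
  aliceUpTo ra h mb (suc i) =
    let r  = aliceUpTo ra h mb i
        qs = proj₁ r
        ms = proj₂ r
    in (qs ++ qA ra (take i h) ms (take i mb) ∷ [])
     , (ms ++ mA ra (take (suc i) h) ms (take i mb) ∷ [])

  bobUpTo : Bits tB → List Query → List Msg → ℕ → List Query × List Msg
  bobUpTo rb h ma zero    = [] , []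
  bobUpTo rb h ma (suc i) =
    let r  = bobUpTo rb h ma i
        qs = proj₁ r
        ms = proj₂ r
    in (qs ++ qB rb (take i h) (take (suc i) ma) ms ∷ [])
     , (ms ++ mB rb (take (suc i) h) (take (suc i) ma) ms ∷ [])

  QA : ℕ → Transcript → ViewA → List Query
  QA k M (ra , h) = proj₁ (aliceUpTo ra h (proj₂ M) ⌈ k /2⌉)

  QB : ℕ → Transcript → ViewB → List Query
  QB k M (rb , h) = proj₁ (bobUpTo rb h (proj₁ M) ⌊ k /2⌋)

  Good : ℕ → Transcript → Info → ViewA → ViewB → Bool
  Good k M I a b =
    allB (λ q → not (elem eqBits q (QB k M b)) ∨ elem eqBits q (QI I)) (QA k M a)

  Edge : ℕ → Transcript → Info → ViewA → ViewB → Bool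
  Edge k M I a b =
    not (anyB (λ q → not (elem eqBits q (QI I)) ∧
                    (elem eqBits q (QB k M b) ∧ not (elem eqBits q (QI I))))
             (QA k M a))

  agrees : Info → Oracle → Bool
  agrees I H = allB (λ qa → eqBits (H (proj₁ qa)) (proj₂ qa)) I

  -- the event defining EXEC(M,I) (after k messages)
  consistent : ℕ → Transcript → Info → Ω → Bool
  consistent k M I ω@(_ , _ , H) = eqTr (transcript k ω) M ∧ agrees I H

  goodω : ℕ → Transcript → Info → Ω → Bool
  goodω k M I ω = consistent k M I ω ∧ Good k M I (viewA k ω) (viewB k ω)

  -- number of (equally likely) samples in EXEC(M,I) ∩ Good(M,I)
  cntGood : ℕ → Transcript → Info → ℕ
  cntGood k M I = count (goodω k M I) allΩ

  cntQ : ℕ → Transcript → Info → Query → ℕ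
  cntQ k M I q = count (λ ω → goodω k M I ω ∧
                   (elem eqBits q (QA k M (viewA k ω)) ∨ elem eqBits q (QB k M (viewB k ω))))
                 allΩ

  cntAB : ℕ → Transcript → Info → ViewA → ViewB → ℕ
  cntAB k M I a b = count (λ ω → goodω k M I ω ∧
                      (eqViewA (viewA k ω) a ∧ eqViewB (viewB k ω) b)) allΩ

  NoRepeat : ℕ → Set
  NoRepeat n = (ω : Ω) →
    Unique (QA (2 Data.Nat.* n) (transcript (2 Data.Nat.* n) ω) (viewA (2 Data.Nat.* n) ω)) ×
    Unique (QB (2 Data.Nat.* n) (transcript (2 Data.Nat.* n) ω) (viewB (2 Data.Nat.* n) ω))

  -- weight of the pair (a , b) under (𝒜 × ℬ) restricted to Good(M,I)
  prodGood : ℕ → Transcript → Info → (ViewA → ℚ) → (ViewB → ℚ) → ViewA → ViewB → ℚ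
  prodGood k M I 𝒜 ℬ a b = if Good k M I a b then 𝒜 a * ℬ b else 0ℚ

  -- normalising constant  Pr_{𝒜×ℬ}[Good(M,I)]
  Zgood : ℕ → Transcript → Info → (ViewA → ℚ) → (ViewB → ℚ) → ℚ
  Zgood k M I 𝒜 ℬ = sumℚ (λ a → sumℚ (λ b → prodGood k M I 𝒜 ℬ a b) (viewsB k)) (viewsA k)

  -- graph G: left vertices = cL a copies of each view a, right = cR b copies of b.
  -- degree of (any copy of) a, and of b; sizes of V_L and V_R
  degL : ℕ → Transcript → Info → (ViewB → ℕ) → ViewA → ℕ
  degL k M I cR a = sumℕ (λ b → if Edge k M I a b then cR b else 0) (viewsB k)

  degR : ℕ → Transcript → Info → (ViewA → ℕ) → ViewB → ℕ
  degR k M I cL b = sumℕ (λ a → if Edge k M I a b then cL a else 0) (viewsA k)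

  sizeL : ℕ → (ViewA → ℕ) → ℕ
  sizeL k cL = sumℕ cL (viewsA k)

  sizeR : ℕ → (ViewB → ℕ) → ℕ
  sizeR k cR = sumℕ cR (viewsB k)

  module Eve (n : ℕ) (ε : ℚ) where

    -- p_q > ε/n, where p_q = cntQ / cntGood (cross-multiplied;
    -- if cntGood = 0 then also cntQ = 0 and q is never heavy)
    heavy : ℕ → Transcript → Info → Query → Bool
    heavy k M I q = ⌊ ε * ℕtoℚ (cntGood k M I) <? ℕtoℚ (cntQ k M I q Data.Nat.* n) ⌋

    firstHeavy : ℕ → Transcript → Info → List Query → List Query
    firstHeavy k M I [] = []
    firstHeavy k M I (q ∷ qs) =
      if not (elem eqBits q (QI I)) ∧ heavy k M I q then q ∷ [] else firstHeavy k M I qs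

    -- Eve's query loop (each iteration adds a new query, so 2^ℓ iterations suffice)
    loop : ℕ → ℕ → Transcript → Oracle → Info → Info
    loop zero       k M H I = I
    loop (suc fuel) k M H I with firstHeavy k M I (allBits ℓ)
    ... | []    = I
    ... | q ∷ _ = loop fuel k M H (I ++ (q , H q) ∷ [])

    -- Eve's set after she has finished her queries following the k-th message
    eveI : ℕ → Ω → Info
    eveI zero    ω@(_ , _ , H) = loop (2 ^ ℓ) zero (transcript zero ω) H []
    eveI (suc k) ω@(_ , _ , H) = loop (2 ^ ℓ) (suc k) (transcript (suc k) ω) H (eveI k ω)

module Submission where

-- Let E be the number of edges of G (vertices are views counted with multiplicity cL, cR).  When Eve
-- stops, every query q ∉ Q(I) has probability at most ε/n under GEXEC(M, I) = (𝒜 × ℬ) | Good, so at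
-- most εE/n edges have an endpoint asking q.  Non-adjacent u and v share a query outside Q(I) and u
-- asks at most n queries, so at most εE edges meet the non-neighbours of u.  Applied to v ∈ V_R, whose
-- neighbours have degree at most |V_R|, this gives E ≤ |V_R| deg(v) + εE, hence deg(v) ≥ E / (2|V_R|);
-- summing over the non-neighbours of u bounds their number by 2ε|V_R|.  Exchanging the sides gives the
-- bound on V_R.  The counting is done in ℕ with ε = p / d cross-multiplied.

open import Data.Nat using (ℕ)
open import Data.Bool using (Bool; true; false)
open import Data.List using (List)
open import Data.List.Membership.Propositional using (_∈_)
open import Relation.Binary.PropositionalEquality using (_≡_)
open import Defs using (Protocol; module Model)

module FiniteSums where

  open import Data.Nat
  open import Data.Nat.Properties
  open import Data.Bool using (Bool; true; false; if_then_else_)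
  open import Data.List using (List; []; _∷_; length)
  open import Data.List.Membership.Propositional using (_∈_)
  open import Data.List.Relation.Unary.Any using (here; there)
  open import Relation.Binary.PropositionalEquality
  open import Data.Nat.Tactic.RingSolver using (solve-∀)
  open import Defs using (sumℕ; count)

  module _ {A : Set} where

    sumℕ-cong : {f g : A → ℕ} (xs : List A) → (∀ x → x ∈ xs → f x ≡ g x) → sumℕ f xs ≡ sumℕ g xs
    sumℕ-cong []       f≡g = refl
    sumℕ-cong (x ∷ xs) f≡g = cong₂ _+_ (f≡g x (here refl)) (sumℕ-cong xs (λ y y∈ → f≡g y (there y∈)))

    sumℕ-mono-≤ : {f g : A → ℕ} (xs : List A) → (∀ x → x ∈ xs → f x ≤ g x) → sumℕ f xs ≤ sumℕ g xs
    sumℕ-mono-≤ []       f≤g = z≤n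
    sumℕ-mono-≤ (x ∷ xs) f≤g = +-mono-≤ (f≤g x (here refl)) (sumℕ-mono-≤ xs (λ y y∈ → f≤g y (there y∈)))

    sumℕ-zero : (xs : List A) → sumℕ (λ _ → 0) xs ≡ 0
    sumℕ-zero []       = refl
    sumℕ-zero (x ∷ xs) = sumℕ-zero xs

    sumℕ-+ : (f g : A → ℕ) (xs : List A) → sumℕ (λ x → f x + g x) xs ≡ sumℕ f xs + sumℕ g xs
    sumℕ-+ f g []       = refl
    sumℕ-+ f g (x ∷ xs) rewrite sumℕ-+ f g xs = interchange (f x) (g x) (sumℕ f xs) (sumℕ g xs)
      where
      interchange : ∀ a b c e → a + b + (c + e) ≡ a + c + (b + e)
      interchange = solve-∀

    sumℕ-*ˡ : (c : ℕ) (f : A → ℕ) (xs : List A) → sumℕ (λ x → c * f x) xs ≡ c * sumℕ f xs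
    sumℕ-*ˡ c f []       = sym (*-zeroʳ c)
    sumℕ-*ˡ c f (x ∷ xs) rewrite sumℕ-*ˡ c f xs = sym (*-distribˡ-+ c (f x) (sumℕ f xs))

    sumℕ-*ʳ : (c : ℕ) (f : A → ℕ) (xs : List A) → sumℕ (λ x → f x * c) xs ≡ sumℕ f xs * c
    sumℕ-*ʳ c f []       = refl
    sumℕ-*ʳ c f (x ∷ xs) rewrite sumℕ-*ʳ c f xs = sym (*-distribʳ-+ c (f x) (sumℕ f xs))

    sumℕ-≤-length* : {f : A → ℕ} {c : ℕ} (xs : List A) → (∀ x → x ∈ xs → f x ≤ c) → sumℕ f xs ≤ length xs * c
    sumℕ-≤-length* []       f≤c = z≤n
    sumℕ-≤-length* (x ∷ xs) f≤c = +-mono-≤ (f≤c x (here refl)) (sumℕ-≤-length* xs (λ y y∈ → f≤c y (there y∈)))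

    ∈⇒≤sumℕ : (f : A → ℕ) {x : A} {xs : List A} → x ∈ xs → f x ≤ sumℕ f xs
    ∈⇒≤sumℕ f {xs = x ∷ xs} (here refl) = m≤m+n (f x) (sumℕ f xs)
    ∈⇒≤sumℕ f {xs = y ∷ xs} (there x∈)  = ≤-trans (∈⇒≤sumℕ f x∈) (m≤n+m (sumℕ f xs) (f y))

    sumℕ-partition : (p : A → Bool) (f : A → ℕ) (xs : List A) →
      sumℕ f xs ≡ sumℕ (λ x → if p x then f x else 0) xs + sumℕ (λ x → if p x then 0 else f x) xs
    sumℕ-partition p f xs = trans (sumℕ-cong xs (λ x _ → split x)) (sumℕ-+ _ _ xs)
      where
      split : ∀ x → f x ≡ (if p x then f x else 0) + (if p x then 0 else f x)
      split x with p x
      ... | true  = sym (+-identityʳ (f x))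
      ... | false = refl

  sumℕ-swap : {A B : Set} (f : A → B → ℕ) (xs : List A) (ys : List B) →
    sumℕ (λ x → sumℕ (f x) ys) xs ≡ sumℕ (λ y → sumℕ (λ x → f x y) xs) ys
  sumℕ-swap f []       ys = sym (sumℕ-zero ys)
  sumℕ-swap f (x ∷ xs) ys rewrite sumℕ-swap f xs ys = sym (sumℕ-+ (f x) (λ y → sumℕ (λ x → f x y) xs) ys)

module RationalBridge where

  open import Data.Nat as ℕ using (suc)
  import Data.Nat.Properties as ℕ
  open import Data.Integer as ℤ using (+_; -[1+_])
  import Data.Integer.Properties as ℤ
  open import Data.Rational using (ℚ; mkℚ; 0ℚ; 1ℚ; _/_; _+_; _*_; _-_; -_; _≤_; _<_)
  open import Data.Rational.Properties
  import Data.Rational.Unnormalised as ℚᵘ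
  import Data.Rational.Unnormalised.Properties as ℚᵘ
  open import Data.Rational.Solver using (module +-*-Solver)
  open +-*-Solver
  open import Data.Nat.Divisibility using (∣1⇒≡1)
  open import Data.Nat.Coprimality using (Coprime)
  open import Data.Empty using (⊥)
  open import Data.Bool using (if_then_else_)
  open import Data.Product using (_,_)
  open import Data.List using ([]; _∷_)
  open import Data.List.Relation.Unary.Any using (here; there)
  open import Relation.Binary.PropositionalEquality
  open import Defs using (ℕtoℚ; sumℕ; sumℚ)

  coprime-1 : ∀ x → Coprime x 1
  coprime-1 x (_ , d∣1) = ∣1⇒≡1 d∣1

  ℕtoℚ≡mkℚ : ∀ x → ℕtoℚ x ≡ mkℚ (+ x) 0 (coprime-1 x)
  ℕtoℚ≡mkℚ x = normalize-coprime (coprime-1 x)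

  ℕtoℚ-cancel-≤ : ∀ {a b} → ℕtoℚ a ≤ ℕtoℚ b → a ℕ.≤ b
  ℕtoℚ-cancel-≤ {a} {b} a≤b rewrite ℕtoℚ≡mkℚ a | ℕtoℚ≡mkℚ b =
    ℤ.drop‿+≤+ (subst₂ ℤ._≤_ (ℤ.*-identityʳ (+ a)) (ℤ.*-identityʳ (+ b)) (drop-*≤* a≤b))

  ℕtoℚ-injective : ∀ {a b} → ℕtoℚ a ≡ ℕtoℚ b → a ≡ b
  ℕtoℚ-injective a≡b = ℕ.≤-antisym (ℕtoℚ-cancel-≤ (≤-reflexive a≡b)) (ℕtoℚ-cancel-≤ (≤-reflexive (sym a≡b)))

  ℕtoℚ-+ : ∀ a b → ℕtoℚ (a ℕ.+ b) ≡ ℕtoℚ a + ℕtoℚ b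
  ℕtoℚ-+ a b rewrite ℕtoℚ≡mkℚ a | ℕtoℚ≡mkℚ b =
    cong (_/ 1) (trans (ℤ.pos-+ a b) (sym (cong₂ ℤ._+_ (ℤ.*-identityʳ (+ a)) (ℤ.*-identityʳ (+ b)))))

  ℕtoℚ-* : ∀ a b → ℕtoℚ (a ℕ.* b) ≡ ℕtoℚ a * ℕtoℚ b
  ℕtoℚ-* a b rewrite ℕtoℚ≡mkℚ a | ℕtoℚ≡mkℚ b = cong (_/ 1) (ℤ.pos-* a b)

  ℕtoℚ-sumℕ : ∀ {A : Set} (f : A → ℕ.ℕ) xs → ℕtoℚ (sumℕ f xs) ≡ sumℚ (λ x → ℕtoℚ (f x)) xs
  ℕtoℚ-sumℕ f []       = refl
  ℕtoℚ-sumℕ f (x ∷ xs) = trans (ℕtoℚ-+ (f x) (sumℕ f xs)) (cong (λ s → ℕtoℚ (f x) + s) (ℕtoℚ-sumℕ f xs))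

  ℕtoℚ-pos : ∀ {z} {q : ℚ} → ℕtoℚ z ≡ q → 0ℚ < q → 0 ℕ.< z
  ℕtoℚ-pos {ℕ.zero} refl 0<0 = ⊥-elim (<-irrefl refl 0<0)
    where open import Data.Empty using (⊥-elim)
  ℕtoℚ-pos {suc z}  _    _   = ℕ.s≤s ℕ.z≤n

  sumℚ-cong : ∀ {A : Set} {f g : A → ℚ} xs → (∀ x → x ∈ xs → f x ≡ g x) → sumℚ f xs ≡ sumℚ g xs
  sumℚ-cong []       f≡g = refl
  sumℚ-cong (x ∷ xs) f≡g = cong₂ _+_ (f≡g x (here refl)) (sumℚ-cong xs (λ y y∈ → f≡g y (there y∈)))

  sumℚ-*ˡ : ∀ {A : Set} (c : ℚ) (f : A → ℚ) xs → sumℚ (λ x → c * f x) xs ≡ c * sumℚ f xs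
  sumℚ-*ˡ c f []       = sym (*-zeroʳ c)
  sumℚ-*ˡ c f (x ∷ xs) = trans (cong (λ s → c * f x + s) (sumℚ-*ˡ c f xs)) (sym (*-distribˡ-+ c (f x) (sumℚ f xs)))

  ℕtoℚ-if-* : ∀ (t : Bool) (x y : ℕ.ℕ) (l r u v : ℚ) → ℕtoℚ x ≡ l * u → ℕtoℚ y ≡ r * v →
    ℕtoℚ (if t then x ℕ.* y else 0) ≡ l * r * (if t then u * v else 0ℚ)
  ℕtoℚ-if-* false x y l r u v _    _    = sym (*-zeroʳ (l * r))
  ℕtoℚ-if-* true  x y l r u v x≡lu y≡rv = trans (ℕtoℚ-* x y) (trans (cong₂ _*_ x≡lu y≡rv) (regroup l r u v))
    where
    regroup : ∀ l r x y → l * x * (r * y) ≡ l * r * (x * y)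
    regroup = solve 4 (λ l r x y → l :* x :* (r :* y) := l :* r :* (x :* y)) refl

  positive-*-* : ∀ {a b c : ℚ} → 0ℚ < a → 0ℚ < b → 0ℚ < c → 0ℚ < a * b * c
  positive-*-* {a} {b} {c} 0<a 0<b 0<c = positive⁻¹ (a * b * c)
    where
    instance
      _ = Data.Rational.positive 0<a
      _ = Data.Rational.positive 0<b
      _ = Data.Rational.positive 0<c
      _ = pos*pos⇒pos a b
      _ = pos*pos⇒pos (a * b) c

  ¬0<negative : ∀ {m d-1} .{c : Coprime (suc m) (suc d-1)} → 0ℚ < mkℚ -[1+ m ] d-1 c → ⊥
  ¬0<negative 0<ε with drop-*<* 0<ε
  ... | ()

  module Fraction (p d-1 : ℕ.ℕ) .(c : Coprime p (suc d-1)) where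

    ε : ℚ
    ε = mkℚ (+ p) d-1 c

    ε<1/10⇒2p≤d : ε < + 1 / 10 → 2 ℕ.* p ℕ.≤ suc d-1
    ε<1/10⇒2p≤d ε<1/10 = ℕ.≤-trans (ℕ.*-monoˡ-≤ p {2} {10} (ℕ.s≤s (ℕ.s≤s ℕ.z≤n)))
                                   (ℕ.<⇒≤ (subst (ℕ._< suc d-1) (ℕ.*-comm p 10) (ℤ.drop‿+<+ cross)))
      where
      cross : + (p ℕ.* 10) ℤ.< + suc d-1
      cross = subst₂ ℤ._<_ (sym (ℤ.pos-* p 10)) (ℤ.*-identityˡ _) (drop-*<* ε<1/10)

    ≤ε*⇒ : ∀ x y → ℕtoℚ x ≤ ε * ℕtoℚ y → x ℕ.* suc d-1 ℕ.≤ p ℕ.* y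
    ≤ε*⇒ x y x≤εy rewrite ℕtoℚ≡mkℚ x | ℕtoℚ≡mkℚ y
      with ℚᵘ.≤-respʳ-≃ (toℚᵘ-homo-* ε (mkℚ (+ y) 0 (coprime-1 y))) (toℚᵘ-mono-≤ x≤εy)
    ... | ℚᵘ.*≤* cross = subst (λ z → x ℕ.* suc z ℕ.≤ p ℕ.* y) (ℕ.*-identityʳ d-1) (ℤ.drop‿+≤+ cross′)
      where
      cross′ : + (x ℕ.* suc (d-1 ℕ.* 1)) ℤ.≤ + (p ℕ.* y)
      cross′ = subst₂ ℤ._≤_ (sym (ℤ.pos-* x (suc (d-1 ℕ.* 1)))) (trans (ℤ.*-identityʳ _) (ℤ.+◃n≡+n (p ℕ.* y))) cross

    ⇒≤ε* : ∀ x y → x ℕ.* suc d-1 ℕ.≤ p ℕ.* y → ℕtoℚ x ≤ ε * ℕtoℚ y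
    ⇒≤ε* x y xd≤py rewrite ℕtoℚ≡mkℚ x | ℕtoℚ≡mkℚ y =
      toℚᵘ-cancel-≤ (ℚᵘ.≤-respʳ-≃ (ℚᵘ.≃-sym (toℚᵘ-homo-* ε (mkℚ (+ y) 0 (coprime-1 y)))) (ℚᵘ.*≤* cross))
      where
      xd≤py′ : x ℕ.* suc (d-1 ℕ.* 1) ℕ.≤ p ℕ.* y
      xd≤py′ = subst (λ z → x ℕ.* suc z ℕ.≤ p ℕ.* y) (sym (ℕ.*-identityʳ d-1)) xd≤py
      cross : + x ℤ.* + suc (d-1 ℕ.* 1) ℤ.≤ (+ p ℤ.* + y) ℤ.* + 1
      cross = subst₂ ℤ._≤_ (ℤ.pos-* x (suc (d-1 ℕ.* 1))) (sym (trans (ℤ.*-identityʳ _) (ℤ.+◃n≡+n (p ℕ.* y))))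
                     (ℤ.+≤+ xd≤py′)

    fraction-bound : ∀ S D δ → S ≡ D ℕ.+ δ → suc d-1 ℕ.* δ ℕ.≤ p ℕ.* (2 ℕ.* S) →
      (1ℚ - ℕtoℚ 2 * ε) * ℕtoℚ S ≤ ℕtoℚ D
    fraction-bound S D δ S≡D+δ dδ≤2pS = begin
      (1ℚ - t * ε) * ℕtoℚ S       ≡⟨ cong ((1ℚ - t * ε) *_) (trans (cong ℕtoℚ S≡D+δ) (ℕtoℚ-+ D δ)) ⟩
      (1ℚ - t * ε) * (u + v)      ≡⟨ expand t ε u v ⟩
      u + v - w                   ≤⟨ +-monoˡ-≤ (- w) (+-monoʳ-≤ u v≤w) ⟩
      u + w - w                   ≡⟨ cancel u w ⟩
      u                           ∎
      where
      open ≤-Reasoning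
      t u v w : ℚ
      t = ℕtoℚ 2
      u = ℕtoℚ D
      v = ℕtoℚ δ
      w = ε * (t * (u + v))
      v≤w : v ≤ w
      v≤w = subst (λ z → v ≤ ε * z) (trans (ℕtoℚ-* 2 S) (cong (t *_) (trans (cong ℕtoℚ S≡D+δ) (ℕtoℚ-+ D δ))))
                  (⇒≤ε* δ (2 ℕ.* S) (subst (ℕ._≤ p ℕ.* (2 ℕ.* S)) (ℕ.*-comm (suc d-1) δ) dδ≤2pS))
      expand : ∀ t e u v → (1ℚ - t * e) * (u + v) ≡ u + v - e * (t * (u + v))
      expand = solve 4 (λ t e u v → (con 1ℚ :- t :* e) :* (u :+ v) := u :+ v :- e :* (t :* (u :+ v))) refl
      cancel : ∀ u w → u + w - w ≡ u
      cancel = solve 2 (λ u w → u :+ w :- w := u) refl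

module BooleanEquality where

  open import Data.Bool using (_∧_; _∨_; if_then_else_)
  open import Data.Bool.Properties using (∧-conicalˡ; ∧-conicalʳ)
  open import Data.List using ([]; _∷_)
  open import Data.Vec using ([]; _∷_)
  open import Data.List.Relation.Unary.Any using (here; there)
  open import Data.Product using (∃-syntax; _×_; _,_)
  open import Relation.Binary.PropositionalEquality
  open import Defs using (Bits; eqB; eqBits; eqList; elem; allB)

  ∧-intro : ∀ {a b} → a ≡ true → b ≡ true → a ∧ b ≡ true
  ∧-intro refl refl = refl

  eqB⇒≡ : ∀ {a b} → eqB a b ≡ true → a ≡ b
  eqB⇒≡ {true}  {true}  _ = refl
  eqB⇒≡ {false} {false} _ = refl

  eqBits⇒≡ : ∀ {k} {u v : Bits k} → eqBits u v ≡ true → u ≡ v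
  eqBits⇒≡ {u = []}    {[]}    _  = refl
  eqBits⇒≡ {u = a ∷ u} {b ∷ v} eq =
    cong₂ _∷_ (eqB⇒≡ (∧-conicalˡ (eqB a b) _ eq)) (eqBits⇒≡ (∧-conicalʳ (eqB a b) _ eq))

  eqBits-refl : ∀ {k} (u : Bits k) → eqBits u u ≡ true
  eqBits-refl []          = refl
  eqBits-refl (true ∷ u)  = eqBits-refl u
  eqBits-refl (false ∷ u) = eqBits-refl u

  module _ {A : Set} {eq : A → A → Bool} where

    eqList⇒≡ : (∀ {x y} → eq x y ≡ true → x ≡ y) → ∀ {xs ys} → eqList eq xs ys ≡ true → xs ≡ ys
    eqList⇒≡ sound {[]}     {[]}     _  = refl
    eqList⇒≡ sound {x ∷ xs} {y ∷ ys} e =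
      cong₂ _∷_ (sound (∧-conicalˡ (eq x y) _ e)) (eqList⇒≡ sound (∧-conicalʳ (eq x y) _ e))

    elem⇒∈ : (∀ {x y} → eq x y ≡ true → x ≡ y) → ∀ {x} xs → elem eq x xs ≡ true → x ∈ xs
    elem⇒∈ sound {x} (y ∷ xs) e with eq x y in x≟y
    ... | true  = here (sound x≟y)
    ... | false = there (elem⇒∈ sound xs e)

    ∈⇒elem : (∀ x → eq x x ≡ true) → ∀ {x xs} → x ∈ xs → elem eq x xs ≡ true
    ∈⇒elem eq-refl {x} (here refl) rewrite eq-refl x = refl
    ∈⇒elem eq-refl {x} {y ∷ xs} (there x∈) with eq x y
    ... | true  = refl
    ... | false = ∈⇒elem eq-refl x∈

  module _ {A : Set} (C : A → Bool) where

    firstᵇ : List A → List A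
    firstᵇ []       = []
    firstᵇ (x ∷ xs) = if C x then x ∷ [] else firstᵇ xs

    firstᵇ≡[]⇒ : ∀ xs → firstᵇ xs ≡ [] → ∀ {x} → x ∈ xs → C x ≡ false
    firstᵇ≡[]⇒ (y ∷ xs) none x∈ with C y in Cy
    firstᵇ≡[]⇒ (y ∷ xs) none (here refl) | false = Cy
    firstᵇ≡[]⇒ (y ∷ xs) none (there x∈)  | false = firstᵇ≡[]⇒ xs none x∈

    firstᵇ≡∷⇒ : ∀ xs {x rest} → firstᵇ xs ≡ x ∷ rest → C x ≡ true
    firstᵇ≡∷⇒ (y ∷ xs) found with C y in Cy
    firstᵇ≡∷⇒ (y ∷ xs) refl  | true  = Cy
    firstᵇ≡∷⇒ (y ∷ xs) found | false = firstᵇ≡∷⇒ xs found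

    all-false⇒firstᵇ≡[] : ∀ xs → (∀ {x} → x ∈ xs → C x ≡ false) → firstᵇ xs ≡ []
    all-false⇒firstᵇ≡[] []       none = refl
    all-false⇒firstᵇ≡[] (x ∷ xs) none rewrite none (here refl) = all-false⇒firstᵇ≡[] xs (λ x∈ → none (there x∈))

  allB≡false⇒ : {A : Set} (p : A → Bool) (xs : List A) → allB p xs ≡ false → ∃[ x ] x ∈ xs × p x ≡ false
  allB≡false⇒ p (x ∷ xs) e with p x in px
  ... | false = x , here refl , px
  ... | true with allB≡false⇒ p xs e
  ... | y , y∈ , py = y , there y∈ , py

module Counting where

  open import Data.Nat
  open import Data.Nat.Properties
  open import Data.Bool using (if_then_else_; _∧_)
  open import Data.List using ([]; _∷_; _++_; map; concatMap; length)
  open import Data.List.Relation.Unary.Any using (here; there)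
  open import Relation.Binary.PropositionalEquality
  open import Defs using (count; sumℕ)
  open FiniteSums

  indicator-mono : ∀ {b c : Bool} → (b ≡ true → c ≡ true) → (if b then 1 else 0) ≤ (if c then 1 else 0)
  indicator-mono {true}  b⇒c rewrite b⇒c refl = ≤-refl
  indicator-mono {false} b⇒c = z≤n

  module _ {A : Set} where

    count-∷ : (p : A → Bool) (x : A) (xs : List A) → count p (x ∷ xs) ≡ (if p x then 1 else 0) + count p xs
    count-∷ p x xs with p x
    ... | true  = refl
    ... | false = refl

    count≡sumℕ : (p : A → Bool) (xs : List A) → count p xs ≡ sumℕ (λ x → if p x then 1 else 0) xs
    count≡sumℕ p []       = refl
    count≡sumℕ p (x ∷ xs) = trans (count-∷ p x xs) (cong (_ +_) (count≡sumℕ p xs))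

    count-none : (xs : List A) → count (λ _ → false) xs ≡ 0
    count-none []       = refl
    count-none (x ∷ xs) = count-none xs

    count-++ : (p : A → Bool) (xs ys : List A) → count p (xs ++ ys) ≡ count p xs + count p ys
    count-++ p []       ys = refl
    count-++ p (x ∷ xs) ys rewrite count-∷ p x (xs ++ ys) | count-∷ p x xs | count-++ p xs ys =
      sym (+-assoc _ (count p xs) (count p ys))

    count-≤-length : (p : A → Bool) (xs : List A) → count p xs ≤ length xs
    count-≤-length p []       = z≤n
    count-≤-length p (x ∷ xs) with p x
    ... | true  = s≤s (count-≤-length p xs)
    ... | false = m≤n⇒m≤1+n (count-≤-length p xs)

    count-cong : {p q : A → Bool} (xs : List A) → (∀ x → p x ≡ q x) → count p xs ≡ count q xs
    count-cong {p} {q} xs p≡q = trans (count≡sumℕ p xs)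
      (trans (sumℕ-cong xs (λ x _ → cong (λ b → if b then 1 else 0) (p≡q x))) (sym (count≡sumℕ q xs)))

    count-mono : {p q : A → Bool} (xs : List A) → (∀ x → p x ≡ true → q x ≡ true) → count p xs ≤ count q xs
    count-mono     []       p⇒q = z≤n
    count-mono {p} {q} (x ∷ xs) p⇒q rewrite count-∷ p x xs | count-∷ q x xs =
      +-mono-≤ (indicator-mono (p⇒q x)) (count-mono xs p⇒q)

    count-mono-< : {p q : A → Bool} (xs : List A) → (∀ x → p x ≡ true → q x ≡ true) →
      ∀ {x} → x ∈ xs → p x ≡ false → q x ≡ true → count p xs < count q xs
    count-mono-< {p} {q} (x ∷ xs) p⇒q (here refl) px qx
      rewrite count-∷ p x xs | count-∷ q x xs | px | qx = s≤s (count-mono xs p⇒q)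
    count-mono-< {p} {q} (y ∷ xs) p⇒q (there x∈) px qx rewrite count-∷ p y xs | count-∷ q y xs =
      +-mono-≤-< (indicator-mono (p⇒q y)) (count-mono-< xs p⇒q x∈ px qx)

    count≡0⇒ : (p : A → Bool) (xs : List A) → count p xs ≡ 0 → ∀ {x} → x ∈ xs → p x ≡ false
    count≡0⇒ p (y ∷ xs) none x∈ with p y in py
    count≡0⇒ p (y ∷ xs) none (here refl) | false = py
    count≡0⇒ p (y ∷ xs) none (there x∈)  | false = count≡0⇒ p xs none x∈

  count-map : {A B : Set} (p : B → Bool) (f : A → B) (xs : List A) → count p (map f xs) ≡ count (λ x → p (f x)) xs
  count-map p f []       = refl
  count-map p f (x ∷ xs) with p (f x)
  ... | true  = cong suc (count-map p f xs)
  ... | false = count-map p f xs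

  count-concatMap : {A B : Set} (p : B → Bool) (f : A → List B) (xs : List A) →
    count p (concatMap f xs) ≡ sumℕ (λ x → count p (f x)) xs
  count-concatMap p f []       = refl
  count-concatMap p f (x ∷ xs) = trans (count-++ p (f x) (concatMap f xs)) (cong (count p (f x) +_) (count-concatMap p f xs))

  count-pairs≤1 : {A B C : Set} (mk : A → B → C) (as : List A) (bs : List B)
    (p : C → Bool) (s : A → Bool) (t : B → Bool) → (∀ a b → p (mk a b) ≡ s a ∧ t b) →
    count s as ≤ 1 → count t bs ≤ 1 → count p (concatMap (λ a → map (mk a) bs) as) ≤ 1
  count-pairs≤1 mk as bs p s t p≡s∧t s≤1 t≤1 = begin
    count p (concatMap (λ a → map (mk a) bs) as) ≡⟨ count-concatMap p _ as ⟩
    sumℕ (λ a → count p (map (mk a) bs)) as      ≡⟨ sumℕ-cong as (λ a _ → split a) ⟩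
    sumℕ (λ a → if s a then count t bs else 0) as ≤⟨ sumℕ-mono-≤ as (λ a _ → at-most-one a) ⟩
    sumℕ (λ a → if s a then 1 else 0) as          ≡⟨ count≡sumℕ s as ⟨
    count s as                                    ≤⟨ s≤1 ⟩
    1                                             ∎
    where
    open ≤-Reasoning
    split : ∀ a → count p (map (mk a) bs) ≡ (if s a then count t bs else 0)
    split a = trans (count-map p (mk a) bs) (trans (count-cong bs (p≡s∧t a)) (by-s (s a)))
      where
      by-s : ∀ b → count (λ y → b ∧ t y) bs ≡ (if b then count t bs else 0)
      by-s true  = refl
      by-s false = count-none bs
    at-most-one : ∀ a → (if s a then count t bs else 0) ≤ (if s a then 1 else 0)
    at-most-one a with s a
    ... | true  = t≤1
    ... | false = z≤n

  count-fibres : {A Ω : Set} (P : Ω → Bool) (key : Ω → A) (same : A → A → Bool) (as : List A) →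
    (∀ ω → count (same (key ω)) as ≤ 1) →
    (ωs : List Ω) → sumℕ (λ a → count (λ ω → P ω ∧ same (key ω) a) ωs) as ≤ count P ωs
  count-fibres P key same as unique [] = ≤-reflexive (sumℕ-zero as)
  count-fibres P key same as unique (ω ∷ ωs) = begin
    sumℕ (λ a → count (λ ω → P ω ∧ same (key ω) a) (ω ∷ ωs)) as
      ≡⟨ sumℕ-cong as (λ a _ → count-∷ (λ ω → P ω ∧ same (key ω) a) ω ωs) ⟩
    sumℕ (λ a → (if P ω ∧ same (key ω) a then 1 else 0) + count (λ ω → P ω ∧ same (key ω) a) ωs) as
      ≡⟨ sumℕ-+ _ _ as ⟩
    sumℕ (λ a → if P ω ∧ same (key ω) a then 1 else 0) as + sumℕ (λ a → count (λ ω → P ω ∧ same (key ω) a) ωs) as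
      ≤⟨ +-mono-≤ (at-ω (P ω)) (count-fibres P key same as unique ωs) ⟩
    (if P ω then 1 else 0) + count P ωs
      ≡⟨ count-∷ P ω ωs ⟨
    count P (ω ∷ ωs) ∎
    where
    open ≤-Reasoning
    at-ω : ∀ b → sumℕ (λ a → if b ∧ same (key ω) a then 1 else 0) as ≤ (if b then 1 else 0)
    at-ω true  = ≤-trans (≤-reflexive (sym (count≡sumℕ (same (key ω)) as))) (unique ω)
    at-ω false = ≤-reflexive (sumℕ-zero as)

module Enumerations where

  open import Data.Nat
  open import Data.Nat.Properties
  open import Data.Bool using (_∧_)
  open import Data.List using ([]; _∷_; _++_; map; length)
  open import Data.List.Properties using (length-++; length-map)
  open import Data.List.Membership.Propositional.Properties using (∈-++⁺ˡ; ∈-++⁺ʳ; ∈-map⁺)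
  open import Data.List.Relation.Unary.Any using (here)
  open import Data.Vec using ([]; _∷_)
  open import Relation.Binary.PropositionalEquality
  open import Defs using (Bits; eqB; eqBits; eqList; allBits; allLists; count)
  open Counting

  allBits-unique : ∀ k (v : Bits k) → count (eqBits v) (allBits k) ≤ 1
  allBits-unique zero    []      = ≤-refl
  allBits-unique (suc k) (b ∷ v) = begin
    count (eqBits (b ∷ v)) (map (false ∷_) (allBits k) ++ map (true ∷_) (allBits k))
      ≡⟨ count-++ (eqBits (b ∷ v)) (map (false ∷_) (allBits k)) _ ⟩
    count (eqBits (b ∷ v)) (map (false ∷_) (allBits k)) + count (eqBits (b ∷ v)) (map (true ∷_) (allBits k))
      ≡⟨ cong₂ _+_ (count-map (eqBits (b ∷ v)) (false ∷_) (allBits k)) (count-map (eqBits (b ∷ v)) (true ∷_) (allBits k)) ⟩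
    count (λ w → eqB b false ∧ eqBits v w) (allBits k) + count (λ w → eqB b true ∧ eqBits v w) (allBits k)
      ≤⟨ by-head b ⟩
    1 ∎
    where
    open ≤-Reasoning
    by-head : ∀ b → count (λ w → eqB b false ∧ eqBits v w) (allBits k)
                  + count (λ w → eqB b true ∧ eqBits v w) (allBits k) ≤ 1
    by-head false rewrite count-none (allBits k) | +-identityʳ (count (eqBits v) (allBits k)) = allBits-unique k v
    by-head true  rewrite count-none (allBits k) = allBits-unique k v

  ∈-allBits : ∀ k (v : Bits k) → v ∈ allBits k
  ∈-allBits zero    []          = here refl
  ∈-allBits (suc k) (false ∷ v) = ∈-++⁺ˡ (∈-map⁺ (false ∷_) (∈-allBits k v))
  ∈-allBits (suc k) (true ∷ v)  = ∈-++⁺ʳ (map (false ∷_) (allBits k)) (∈-map⁺ (true ∷_) (∈-allBits k v))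

  length-allBits : ∀ k → length (allBits k) ≡ 2 ^ k
  length-allBits zero    = refl
  length-allBits (suc k) = begin
    length (map (false ∷_) (allBits k) ++ map (true ∷_) (allBits k))
      ≡⟨ length-++ (map (false ∷_) (allBits k)) ⟩
    length (map (false ∷_) (allBits k)) + length (map (true ∷_) (allBits k))
      ≡⟨ cong₂ _+_ (length-map (false ∷_) (allBits k)) (length-map (true ∷_) (allBits k)) ⟩
    length (allBits k) + length (allBits k)
      ≡⟨ cong (λ m → m + m) (length-allBits k) ⟩
    2 ^ k + 2 ^ k
      ≡⟨ cong (2 ^ k +_) (+-identityʳ (2 ^ k)) ⟨
    2 ^ (suc k) ∎
    where open ≡-Reasoning

  allLists-unique : {A : Set} (eq : A → A → Bool) (xs : List A) → (∀ x → count (eq x) xs ≤ 1) →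
    ∀ m h → count (eqList eq h) (allLists xs m) ≤ 1
  allLists-unique eq xs unique zero    h       = count-≤-length (eqList eq h) ([] ∷ [])
  allLists-unique eq xs unique (suc m) []      =
    count-pairs≤1 _∷_ xs (allLists xs m) (eqList eq []) (λ _ → false) (λ _ → false) (λ _ _ → refl)
                  (none≤1 xs) (none≤1 (allLists xs m))
    where
    none≤1 : ∀ {B : Set} (ys : List B) → count (λ _ → false) ys ≤ 1
    none≤1 ys = ≤-trans (≤-reflexive (count-none ys)) z≤n
  allLists-unique eq xs unique (suc m) (y ∷ h) =
    count-pairs≤1 _∷_ xs (allLists xs m) (eqList eq (y ∷ h)) (eq y) (eqList eq h) (λ _ _ → refl)
                  (unique y) (allLists-unique eq xs unique m h)

module NatArithmetic where

  open import Data.Nat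
  open import Data.Nat.Properties
  open import Relation.Binary.PropositionalEquality
  open import Data.Nat.Tactic.RingSolver using (solve-∀)

  absorb-half : ∀ {a p d e : ℕ} → 2 * p ≤ d → d * e ≤ a + p * e → d * e ≤ 2 * a
  absorb-half {a} {p} {d} {e} 2p≤d de≤a+pe = +-cancelʳ-≤ (d * e) (d * e) (2 * a) (begin
    d * e + d * e         ≡⟨ double (d * e) ⟩
    2 * (d * e)           ≤⟨ *-monoʳ-≤ 2 de≤a+pe ⟩
    2 * (a + p * e)       ≡⟨ distribute a p e ⟩
    2 * a + 2 * p * e     ≤⟨ +-monoʳ-≤ (2 * a) (*-monoˡ-≤ e 2p≤d) ⟩
    2 * a + d * e         ∎)
    where
    open ≤-Reasoning
    double : ∀ m → m + m ≡ 2 * m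
    double = solve-∀
    distribute : ∀ a p e → 2 * (a + p * e) ≡ 2 * a + 2 * p * e
    distribute = solve-∀

  ratio-≤-trans : ∀ {w e c g m p : ℕ} .{{_ : NonZero g}} → w * g ≤ c * e → c * m ≤ p * g → m * w ≤ p * e
  ratio-≤-trans {w} {e} {c} {g} {m} {p} wg≤ce cm≤pg = *-cancelʳ-≤ (m * w) (p * e) g (begin
    m * w * g        ≡⟨ *-assoc m w g ⟩
    m * (w * g)      ≤⟨ *-monoʳ-≤ m wg≤ce ⟩
    m * (c * e)      ≡⟨ rearrange m c e ⟩
    c * m * e        ≤⟨ *-monoˡ-≤ e cm≤pg ⟩
    p * g * e        ≡⟨ swap-last p g e ⟩
    p * e * g        ∎)
    where
    open ≤-Reasoning
    rearrange : ∀ m c e → m * (c * e) ≡ c * m * e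
    rearrange = solve-∀
    swap-last : ∀ p g e → p * g * e ≡ p * e * g
    swap-last = solve-∀

  <2*⇒nonZero : ∀ {k n} → k < 2 * n → NonZero n
  <2*⇒nonZero {n = suc n} _ = _

  ⌈k/2⌉≤n : ∀ {k n} → k < 2 * n → ⌈ k /2⌉ ≤ n
  ⌈k/2⌉≤n {k} {n} k<2n = begin
    ⌈ k /2⌉          ≤⟨ ⌈n/2⌉-mono (≤-trans (n≤1+n k) (≤-trans k<2n (≤-reflexive (cong (n +_) (+-identityʳ n))))) ⟩
    ⌈ n + n /2⌉      ≡⟨ n≡⌈n+n/2⌉ n ⟨
    n                ∎
    where open ≤-Reasoning

module WeightedGraph
  {X Y Q : Set} (xs : List X) (ys : List Y) (wx : X → ℕ) (wy : Y → ℕ)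
  (adj : X → Y → Bool) (Qx : X → List Q) (Qy : Y → List Q)
  (fresh : Q → Bool) (asks : Q → List Q → Bool) (∈⇒asks : ∀ {q qs} → q ∈ qs → asks q qs ≡ true) where

  open import Data.Nat
  open import Data.Nat.Properties
  open import Data.Bool using (if_then_else_; _∧_; _∨_)
  import Data.Bool.Properties
  open import Data.List using (length)
  open import Data.Product using (∃-syntax; _×_; _,_)
  open import Relation.Binary.PropositionalEquality
  open import Defs using (sumℕ)
  open FiniteSums

  degX : X → ℕ
  degX x = sumℕ (λ y → if adj x y then wy y else 0) ys

  degY : Y → ℕ
  degY y = sumℕ (λ x → if adj x y then wx x else 0) xs

  sizeY : ℕ
  sizeY = sumℕ wy ys

  nonDegX : X → ℕ
  nonDegX x = sumℕ (λ y → if adj x y then 0 else wy y) ys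

  edges : ℕ
  edges = sumℕ (λ x → sumℕ (λ y → if adj x y then wx x * wy y else 0) ys) xs

  edgesAsking : Q → ℕ
  edgesAsking q =
    sumℕ (λ x → sumℕ (λ y → if adj x y ∧ (asks q (Qx x) ∨ asks q (Qy y)) then wx x * wy y else 0) ys) xs

  nonNbrEdges : X → ℕ
  nonNbrEdges x = sumℕ (λ y → if adj x y then 0 else wy y * degY y) ys

  Conflicts : Set
  Conflicts = ∀ x y → adj x y ≡ false → ∃[ q ] fresh q ≡ true × q ∈ Qx x × q ∈ Qy y

  Light : ℕ → ℕ → ℕ → Set
  Light n p d = ∀ q → fresh q ≡ true → n * d * edgesAsking q ≤ p * edges

  private
    freshEdgesAt : Q → Y → ℕ
    freshEdgesAt q y = if fresh q ∧ asks q (Qy y) then wy y * degY y else 0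

  nonNbrEdges-≤ : Conflicts → ∀ x → nonNbrEdges x ≤ sumℕ (λ q → sumℕ (freshEdgesAt q) ys) (Qx x)
  nonNbrEdges-≤ conflicts x = begin
    nonNbrEdges x                                        ≤⟨ sumℕ-mono-≤ ys (λ y _ → charged y) ⟩
    sumℕ (λ y → sumℕ (λ q → freshEdgesAt q y) (Qx x)) ys ≡⟨ sumℕ-swap (λ y q → freshEdgesAt q y) ys (Qx x) ⟩
    sumℕ (λ q → sumℕ (freshEdgesAt q) ys) (Qx x)          ∎
    where
    open ≤-Reasoning
    charged : ∀ y → (if adj x y then 0 else wy y * degY y) ≤ sumℕ (λ q → freshEdgesAt q y) (Qx x)
    charged y with adj x y in nonadj
    ... | true  = z≤n
    ... | false with conflicts x y nonadj
    ... | q , q-fresh , q∈Qx , q∈Qy =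
      subst (_≤ sumℕ (λ q → freshEdgesAt q y) (Qx x)) at-q (∈⇒≤sumℕ (λ q → freshEdgesAt q y) q∈Qx)
      where
      at-q : freshEdgesAt q y ≡ wy y * degY y
      at-q rewrite q-fresh | ∈⇒asks q∈Qy = refl

  freshEdgesAt-≤ : ∀ q → fresh q ≡ true → sumℕ (freshEdgesAt q) ys ≤ edgesAsking q
  freshEdgesAt-≤ q q-fresh = begin
    sumℕ (freshEdgesAt q) ys
      ≤⟨ sumℕ-mono-≤ ys (λ y _ → expand y) ⟩
    sumℕ (λ y → sumℕ (λ x → if adj x y ∧ (asks q (Qx x) ∨ asks q (Qy y)) then wx x * wy y else 0) xs) ys
      ≡⟨ sumℕ-swap (λ y x → if adj x y ∧ (asks q (Qx x) ∨ asks q (Qy y)) then wx x * wy y else 0) ys xs ⟩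
    edgesAsking q ∎
    where
    open ≤-Reasoning
    edge : ∀ x y → wy y * (if adj x y then wx x else 0) ≤ (if adj x y ∧ (asks q (Qx x) ∨ true) then wx x * wy y else 0)
    edge x y rewrite Data.Bool.Properties.∨-zeroʳ (asks q (Qx x)) with adj x y
    ... | true  = ≤-reflexive (*-comm (wy y) (wx x))
    ... | false = ≤-reflexive (*-zeroʳ (wy y))
    expand : ∀ y → freshEdgesAt q y ≤
      sumℕ (λ x → if adj x y ∧ (asks q (Qx x) ∨ asks q (Qy y)) then wx x * wy y else 0) xs
    expand y rewrite q-fresh with asks q (Qy y)
    ... | false = z≤n
    ... | true  = ≤-trans (≤-reflexive (sym (sumℕ-*ˡ (wy y) (λ x → if adj x y then wx x else 0) xs)))
                          (sumℕ-mono-≤ xs (λ x _ → edge x y))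

  module _ (n p d : ℕ) .{{_ : NonZero n}} (light : Light n p d) where

    freshEdgesAt-bound : ∀ q → n * (d * sumℕ (freshEdgesAt q) ys) ≤ p * edges
    freshEdgesAt-bound q = by-freshness (fresh q) refl
      where
      by-freshness : ∀ b → fresh q ≡ b → n * (d * sumℕ (freshEdgesAt q) ys) ≤ p * edges
      by-freshness true  q-fresh = ≤-trans (≤-reflexive (sym (*-assoc n d _)))
        (≤-trans (*-monoʳ-≤ (n * d) (freshEdgesAt-≤ q q-fresh)) (light q q-fresh))
      by-freshness false q-stale = ≤-trans (≤-reflexive no-edges) z≤n
        where
        no-edges : n * (d * sumℕ (freshEdgesAt q) ys) ≡ 0
        no-edges rewrite sumℕ-cong {g = λ _ → 0} ys
                           (λ y _ → cong (λ b → if b ∧ asks q (Qy y) then wy y * degY y else 0) q-stale)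
                       | sumℕ-zero ys | *-zeroʳ d = *-zeroʳ n

    nonNbrEdges-bound : Conflicts → ∀ x → length (Qx x) ≤ n → d * nonNbrEdges x ≤ p * edges
    nonNbrEdges-bound conflicts x |Qx|≤n = *-cancelˡ-≤ n (begin
      n * (d * nonNbrEdges x)                                  ≤⟨ *-monoʳ-≤ n (*-monoʳ-≤ d (nonNbrEdges-≤ conflicts x)) ⟩
      n * (d * sumℕ F (Qx x))                                  ≡⟨ cong (n *_) (sym (sumℕ-*ˡ d F (Qx x))) ⟩
      n * sumℕ (λ q → d * F q) (Qx x)                          ≡⟨ sym (sumℕ-*ˡ n (λ q → d * F q) (Qx x)) ⟩
      sumℕ (λ q → n * (d * F q)) (Qx x)                        ≤⟨ sumℕ-≤-length* (Qx x) (λ q _ → freshEdgesAt-bound q) ⟩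
      length (Qx x) * (p * edges)                              ≤⟨ *-monoˡ-≤ (p * edges) |Qx|≤n ⟩
      n * (p * edges)                                          ∎)
      where
      open ≤-Reasoning
      F : Q → ℕ
      F q = sumℕ (freshEdgesAt q) ys

module ConflictGraph
  {X Y Q : Set} (xs : List X) (ys : List Y) (wx : X → ℕ) (wy : Y → ℕ)
  (adj : X → Y → Bool) (Qx : X → List Q) (Qy : Y → List Q)
  (fresh : Q → Bool) (asks : Q → List Q → Bool) (∈⇒asks : ∀ {q qs} → q ∈ qs → asks q qs ≡ true) where

  open import Data.Nat
  open import Data.Nat.Properties
  open import Data.Bool using (if_then_else_; _∧_; _∨_)
  import Data.Bool.Properties
  open import Data.List using (length)
  open import Data.Product using (_,_)
  open import Function using (flip)
  open import Relation.Binary.PropositionalEquality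
  open import Data.Nat.Tactic.RingSolver using (solve-∀)
  open import Defs using (sumℕ)
  open FiniteSums
  open NatArithmetic

  open WeightedGraph xs ys wx wy adj Qx Qy fresh asks ∈⇒asks public
  module ᵀ = WeightedGraph ys xs wy wx (flip adj) Qy Qx fresh asks ∈⇒asks

  edges-transpose : ᵀ.edges ≡ edges
  edges-transpose = trans (sumℕ-swap (λ y x → if adj x y then wy y * wx x else 0) ys xs)
                          (sumℕ-cong xs (λ x _ → sumℕ-cong ys (λ y _ → commute x y)))
    where
    commute : ∀ x y → (if adj x y then wy y * wx x else 0) ≡ (if adj x y then wx x * wy y else 0)
    commute x y rewrite *-comm (wy y) (wx x) = refl

  edgesAsking-transpose : ∀ q → ᵀ.edgesAsking q ≡ edgesAsking q
  edgesAsking-transpose q =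
    trans (sumℕ-swap (λ y x → if adj x y ∧ (asks q (Qy y) ∨ asks q (Qx x)) then wy y * wx x else 0) ys xs)
          (sumℕ-cong xs (λ x _ → sumℕ-cong ys (λ y _ → commute x y)))
    where
    commute : ∀ x y → (if adj x y ∧ (asks q (Qy y) ∨ asks q (Qx x)) then wy y * wx x else 0)
                    ≡ (if adj x y ∧ (asks q (Qx x) ∨ asks q (Qy y)) then wx x * wy y else 0)
    commute x y rewrite Data.Bool.Properties.∨-comm (asks q (Qy y)) (asks q (Qx x)) | *-comm (wy y) (wx x) = refl

  conflicts-transpose : Conflicts → ᵀ.Conflicts
  conflicts-transpose conflicts y x nonadj with conflicts x y nonadj
  ... | q , q-fresh , q∈Qx , q∈Qy = q , q-fresh , q∈Qy , q∈Qx

  light-transpose : ∀ {n p d} → Light n p d → ᵀ.Light n p d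
  light-transpose {n} {p} {d} light q q-fresh
    rewrite edgesAsking-transpose q | edges-transpose = light q q-fresh

  sizeY-split : ∀ x → sizeY ≡ degX x + nonDegX x
  sizeY-split x = sumℕ-partition (adj x) wy ys

  degX≤sizeY : ∀ x → degX x ≤ sizeY
  degX≤sizeY x = sumℕ-mono-≤ ys (λ y _ → dropped y)
    where
    dropped : ∀ y → (if adj x y then wy y else 0) ≤ wy y
    dropped y with adj x y
    ... | true  = ≤-refl
    ... | false = z≤n

  edges≡sum-degX : edges ≡ sumℕ (λ x → wx x * degX x) xs
  edges≡sum-degX = sumℕ-cong xs (λ x _ → trans (sumℕ-cong ys (λ y _ → factor x y))
                                               (sumℕ-*ˡ (wx x) (λ y → if adj x y then wy y else 0) ys))
    where
    factor : ∀ x y → (if adj x y then wx x * wy y else 0) ≡ wx x * (if adj x y then wy y else 0)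
    factor x y with adj x y
    ... | true  = refl
    ... | false = sym (*-zeroʳ (wx x))

  -- Split the edges by whether their X-end is a neighbour of y; the neighbours carry at most sizeY each.
  edges≤ : ∀ y → edges ≤ sizeY * degY y + ᵀ.nonNbrEdges y
  edges≤ y = begin
    edges                                                           ≡⟨ edges≡sum-degX ⟩
    sumℕ (λ x → wx x * degX x) xs                                   ≡⟨ sumℕ-partition (flip adj y) _ xs ⟩
    sumℕ (λ x → if adj x y then wx x * degX x else 0) xs + ᵀ.nonNbrEdges y
      ≤⟨ +-monoˡ-≤ (ᵀ.nonNbrEdges y) (sumℕ-mono-≤ xs (λ x _ → nbr x)) ⟩
    sumℕ (λ x → sizeY * (if adj x y then wx x else 0)) xs + ᵀ.nonNbrEdges y
      ≡⟨ cong (_+ ᵀ.nonNbrEdges y) (sumℕ-*ˡ sizeY (λ x → if adj x y then wx x else 0) xs) ⟩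
    sizeY * degY y + ᵀ.nonNbrEdges y ∎
    where
    open ≤-Reasoning
    nbr : ∀ x → (if adj x y then wx x * degX x else 0) ≤ sizeY * (if adj x y then wx x else 0)
    nbr x with adj x y
    ... | true  = ≤-trans (*-monoʳ-≤ (wx x) (degX≤sizeY x)) (≤-reflexive (*-comm (wx x) sizeY))
    ... | false = z≤n

  module _ (n p d : ℕ) .{{_ : NonZero n}} .{{_ : NonZero d}} (2p≤d : 2 * p ≤ d)
           (conflicts : Conflicts) (light : Light n p d)
           (|Qx|≤n : ∀ x → length (Qx x) ≤ n) (|Qy|≤n : ∀ y → length (Qy y) ≤ n) where

    edges≤2*sizeY*degY : ∀ y → edges ≤ 2 * sizeY * degY y
    edges≤2*sizeY*degY y = *-cancelˡ-≤ d (begin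
      d * edges                     ≤⟨ absorb-half {d * (sizeY * degY y)} {p} 2p≤d (begin
        d * edges                                    ≤⟨ *-monoʳ-≤ d (edges≤ y) ⟩
        d * (sizeY * degY y + ᵀ.nonNbrEdges y)       ≡⟨ *-distribˡ-+ d (sizeY * degY y) _ ⟩
        d * (sizeY * degY y) + d * ᵀ.nonNbrEdges y   ≤⟨ +-monoʳ-≤ (d * (sizeY * degY y)) transposed ⟩
        d * (sizeY * degY y) + p * edges             ∎) ⟩
      2 * (d * (sizeY * degY y))    ≡⟨ reassociate d sizeY (degY y) ⟩
      d * (2 * sizeY * degY y)      ∎)
      where
      open ≤-Reasoning
      transposed : d * ᵀ.nonNbrEdges y ≤ p * edges
      transposed = subst (λ e → d * ᵀ.nonNbrEdges y ≤ p * e) edges-transpose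
        (ᵀ.nonNbrEdges-bound n p d (light-transpose {n} {p} {d} light) (conflicts-transpose conflicts) y (|Qy|≤n y))
      reassociate : ∀ d s g → 2 * (d * (s * g)) ≡ d * (2 * s * g)
      reassociate = solve-∀

    -- Each non-neighbour y of x has degY y ≥ edges / (2 sizeY), so its weight is paid for by its edges.
    nonDegX-bound : 0 < edges → ∀ x → d * nonDegX x ≤ p * (2 * sizeY)
    nonDegX-bound edges>0 x = *-cancelʳ-≤ (d * nonDegX x) (p * (2 * sizeY)) edges {{>-nonZero edges>0}} (begin
      d * nonDegX x * edges            ≡⟨ *-assoc d (nonDegX x) edges ⟩
      d * (nonDegX x * edges)          ≤⟨ *-monoʳ-≤ d weighted ⟩
      d * (2 * sizeY * nonNbrEdges x)  ≡⟨ regroup d (2 * sizeY) (nonNbrEdges x) ⟩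
      2 * sizeY * (d * nonNbrEdges x)  ≤⟨ *-monoʳ-≤ (2 * sizeY) (nonNbrEdges-bound n p d light conflicts x (|Qx|≤n x)) ⟩
      2 * sizeY * (p * edges)          ≡⟨ regroup (2 * sizeY) p edges ⟩
      p * (2 * sizeY * edges)          ≡⟨ sym (*-assoc p (2 * sizeY) edges) ⟩
      p * (2 * sizeY) * edges          ∎)
      where
      open ≤-Reasoning
      regroup : ∀ a b c → a * (b * c) ≡ b * (a * c)
      regroup = solve-∀
      paid : ∀ y → (if adj x y then 0 else wy y) * edges ≤ 2 * sizeY * (if adj x y then 0 else wy y * degY y)
      paid y with adj x y
      ... | true  = z≤n
      ... | false = ≤-trans (*-monoʳ-≤ (wy y) (edges≤2*sizeY*degY y)) (≤-reflexive (regroup (wy y) (2 * sizeY) (degY y)))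
      weighted : nonDegX x * edges ≤ 2 * sizeY * nonNbrEdges x
      weighted = begin
        nonDegX x * edges                                            ≡⟨ sym (sumℕ-*ʳ edges _ ys) ⟩
        sumℕ (λ y → (if adj x y then 0 else wy y) * edges) ys        ≤⟨ sumℕ-mono-≤ ys (λ y _ → paid y) ⟩
        sumℕ (λ y → 2 * sizeY * (if adj x y then 0 else wy y * degY y)) ys ≡⟨ sumℕ-*ˡ (2 * sizeY) _ ys ⟩
        2 * sizeY * nonNbrEdges x                                    ∎

module ProtocolFacts {ℓ tA tB mlen : ℕ} (P : Protocol ℓ tA tB mlen) where

  open import Data.Nat
  open import Data.Nat.Properties
  open import Data.Bool using (if_then_else_; _∧_; _∨_; not)
  open import Data.Bool.Properties using (∧-conicalˡ; ∧-conicalʳ; ∨-conicalˡ; ∨-conicalʳ; not-injective)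
  open import Data.List using ([]; _∷_; _++_; map; length)
  open import Data.List.Properties using (length-++; map-++)
  open import Data.List.Relation.Unary.Any using (here; there)
  import Data.Rational
  import Data.Bool.Properties
  open import Data.Product using (∃-syntax; _×_; _,_; proj₁; proj₂)
  open import Relation.Binary.PropositionalEquality
  open Model P
  open import Defs using (Bits; eqBits; eqList; elem; anyB; allB; count; allBits; allLists; sumℕ; ℕtoℚ)
  open import Data.Bool using (T)
  open import Data.Unit using (tt)
  open import Relation.Nullary.Decidable using (toWitnessFalse)
  import Data.Rational.Properties
  open FiniteSums
  open BooleanEquality
  open Counting
  open Enumerations
  open NatArithmetic

  aliceUpTo-length : ∀ ra h mb i → length (proj₁ (aliceUpTo ra h mb i)) ≡ i
  aliceUpTo-length ra h mb zero    = refl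
  aliceUpTo-length ra h mb (suc i) =
    trans (length-++ (proj₁ (aliceUpTo ra h mb i))) (trans (cong (_+ 1) (aliceUpTo-length ra h mb i)) (+-comm i 1))

  bobUpTo-length : ∀ rb h ma i → length (proj₁ (bobUpTo rb h ma i)) ≡ i
  bobUpTo-length rb h ma zero    = refl
  bobUpTo-length rb h ma (suc i) =
    trans (length-++ (proj₁ (bobUpTo rb h ma i))) (trans (cong (_+ 1) (bobUpTo-length rb h ma i)) (+-comm i 1))

  QA-length : ∀ {n k} M a → k < 2 * n → length (QA k M a) ≤ n
  QA-length {k = k} M (ra , h) k<2n rewrite aliceUpTo-length ra h (proj₂ M) ⌈ k /2⌉ = ⌈k/2⌉≤n k<2n

  QB-length : ∀ {n k} M b → k < 2 * n → length (QB k M b) ≤ n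
  QB-length {k = k} M (rb , h) k<2n rewrite bobUpTo-length rb h (proj₁ M) ⌊ k /2⌋ =
    ≤-trans (⌊n/2⌋≤⌈n/2⌉ k) (⌈k/2⌉≤n k<2n)

  fresh : Info → Query → Bool
  fresh I q = not (elem eqBits q (QI I))

  asks : Query → List Query → Bool
  asks = elem eqBits

  ∈⇒asks : ∀ {q qs} → q ∈ qs → asks q qs ≡ true
  ∈⇒asks = ∈⇒elem eqBits-refl

  ¬Good⇒sharedFresh : ∀ k M I a b → Good k M I a b ≡ false →
    ∃[ q ] fresh I q ≡ true × q ∈ QA k M a × q ∈ QB k M b
  ¬Good⇒sharedFresh k M I a b ¬good
    with allB≡false⇒ (λ q → not (asks q (QB k M b)) ∨ asks q (QI I)) (QA k M a) ¬good
  ... | q , q∈QA , unguarded =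
    q , cong not (∨-conicalʳ _ _ unguarded) , q∈QA ,
    elem⇒∈ eqBits⇒≡ (QB k M b) (not-injective (∨-conicalˡ _ _ unguarded))

  Edge≡Good : ∀ k M I a b → Edge k M I a b ≡ Good k M I a b
  Edge≡Good k M I a b = pointwise (QA k M a)
    where
    pointwise : ∀ qs → not (anyB (λ q → fresh I q ∧ (asks q (QB k M b) ∧ fresh I q)) qs)
                     ≡ allB (λ q → not (asks q (QB k M b)) ∨ asks q (QI I)) qs
    pointwise []       = refl
    pointwise (q ∷ qs) with asks q (QI I) | asks q (QB k M b)
    ... | true  | true  = pointwise qs
    ... | true  | false = pointwise qs
    ... | false | true  = refl
    ... | false | false = pointwise qs

  eqViewA⇒≡ : ∀ {u v} → eqViewA u v ≡ true → u ≡ v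
  eqViewA⇒≡ {r , h} {r′ , h′} e =
    cong₂ _,_ (eqBits⇒≡ (∧-conicalˡ _ _ e)) (eqList⇒≡ eqBits⇒≡ (∧-conicalʳ (eqBits r r′) _ e))

  eqViewB⇒≡ : ∀ {u v} → eqViewB u v ≡ true → u ≡ v
  eqViewB⇒≡ {r , h} {r′ , h′} e =
    cong₂ _,_ (eqBits⇒≡ (∧-conicalˡ _ _ e)) (eqList⇒≡ eqBits⇒≡ (∧-conicalʳ (eqBits r r′) _ e))

  viewsA-unique : ∀ k v → count (eqViewA v) (viewsA k) ≤ 1
  viewsA-unique k (r , h) =
    count-pairs≤1 _,_ (allBits tA) (allLists (allBits ℓ) ⌈ k /2⌉) (eqViewA (r , h)) (eqBits r) (eqList eqBits h)
      (λ _ _ → refl) (allBits-unique tA r) (allLists-unique eqBits (allBits ℓ) (allBits-unique ℓ) ⌈ k /2⌉ h)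

  viewsB-unique : ∀ k v → count (eqViewB v) (viewsB k) ≤ 1
  viewsB-unique k (r , h) =
    count-pairs≤1 _,_ (allBits tB) (allLists (allBits ℓ) ⌊ k /2⌋) (eqViewB (r , h)) (eqBits r) (eqList eqBits h)
      (λ _ _ → refl) (allBits-unique tB r) (allLists-unique eqBits (allBits ℓ) (allBits-unique ℓ) ⌊ k /2⌋ h)

  asksEither : ℕ → Transcript → Query → ViewA → ViewB → Bool
  asksEither k M q a b = asks q (QA k M a) ∨ asks q (QB k M b)

  -- Distinct view pairs come from disjoint sets of samples.
  askingPairs≤cntQ : ∀ k M I q →
    sumℕ (λ a → sumℕ (λ b → if Good k M I a b ∧ asksEither k M q a b then cntAB k M I a b else 0) (viewsB k)) (viewsA k)
      ≤ cntQ k M I q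
  askingPairs≤cntQ k M I q = begin
    sumℕ (λ a → sumℕ (λ b → if Good k M I a b ∧ asksEither k M q a b then cntAB k M I a b else 0) (viewsB k)) (viewsA k)
      ≤⟨ sumℕ-mono-≤ (viewsA k) (λ a _ → sumℕ-mono-≤ (viewsB k) (λ b _ → pair≤fibre a b)) ⟩
    sumℕ (λ a → sumℕ (λ b → count (λ ω → (R ω ∧ eqViewA (viewA k ω) a) ∧ eqViewB (viewB k ω) b) allΩ) (viewsB k)) (viewsA k)
      ≤⟨ sumℕ-mono-≤ (viewsA k) (λ a _ →
           count-fibres (λ ω → R ω ∧ eqViewA (viewA k ω) a) (viewB k) eqViewB (viewsB k)
                        (λ ω → viewsB-unique k (viewB k ω)) allΩ) ⟩
    sumℕ (λ a → count (λ ω → R ω ∧ eqViewA (viewA k ω) a) allΩ) (viewsA k)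
      ≤⟨ count-fibres R (viewA k) eqViewA (viewsA k) (λ ω → viewsA-unique k (viewA k ω)) allΩ ⟩
    cntQ k M I q ∎
    where
    open ≤-Reasoning
    R : Ω → Bool
    R ω = goodω k M I ω ∧ asksEither k M q (viewA k ω) (viewB k ω)
    pair≤fibre : ∀ a b → (if Good k M I a b ∧ asksEither k M q a b then cntAB k M I a b else 0)
                         ≤ count (λ ω → (R ω ∧ eqViewA (viewA k ω) a) ∧ eqViewB (viewB k ω) b) allΩ
    pair≤fibre a b with Good k M I a b ∧ asksEither k M q a b in asking
    ... | false = z≤n
    ... | true  = count-mono allΩ sample
      where
      sample : ∀ ω → goodω k M I ω ∧ (eqViewA (viewA k ω) a ∧ eqViewB (viewB k ω) b) ≡ true →
               (R ω ∧ eqViewA (viewA k ω) a) ∧ eqViewB (viewB k ω) b ≡ true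
      sample ω e = ∧-intro (∧-intro (∧-intro good asked) sameA) sameB
        where
        views : eqViewA (viewA k ω) a ∧ eqViewB (viewB k ω) b ≡ true
        views = ∧-conicalʳ (goodω k M I ω) _ e
        good : goodω k M I ω ≡ true
        good = ∧-conicalˡ (goodω k M I ω) _ e
        sameA : eqViewA (viewA k ω) a ≡ true
        sameA = ∧-conicalˡ (eqViewA (viewA k ω) a) _ views
        sameB : eqViewB (viewB k ω) b ≡ true
        sameB = ∧-conicalʳ (eqViewA (viewA k ω) a) _ views
        asked : asksEither k M q (viewA k ω) (viewB k ω) ≡ true
        asked = subst₂ (λ u v → asksEither k M q u v ≡ true) (sym (eqViewA⇒≡ sameA)) (sym (eqViewB⇒≡ sameB))
                       (∧-conicalʳ (Good k M I a b) _ asking)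

  module EveFacts (n : ℕ) (ε : Data.Rational.ℚ) where

    open Eve n ε

    freshHeavy : ℕ → Transcript → Info → Query → Bool
    freshHeavy k M I q = fresh I q ∧ heavy k M I q

    firstHeavy≡firstᵇ : ∀ k M I qs → firstHeavy k M I qs ≡ firstᵇ (freshHeavy k M I) qs
    firstHeavy≡firstᵇ k M I []       = refl
    firstHeavy≡firstᵇ k M I (q ∷ qs) =
      cong (λ rest → if fresh I q ∧ heavy k M I q then q ∷ [] else rest) (firstHeavy≡firstᵇ k M I qs)

    firstHeavy≡[]⇒ : ∀ k M I → firstHeavy k M I (allBits ℓ) ≡ [] → ∀ q → freshHeavy k M I q ≡ false
    firstHeavy≡[]⇒ k M I none q =
      firstᵇ≡[]⇒ (freshHeavy k M I) (allBits ℓ) (trans (sym (firstHeavy≡firstᵇ k M I (allBits ℓ))) none) (∈-allBits ℓ q)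

    firstHeavy≡∷⇒fresh : ∀ k M I {q rest} → firstHeavy k M I (allBits ℓ) ≡ q ∷ rest → fresh I q ≡ true
    firstHeavy≡∷⇒fresh k M I {q} found = ∧-conicalˡ (fresh I q) (heavy k M I q)
      (firstᵇ≡∷⇒ (freshHeavy k M I) (allBits ℓ) (trans (sym (firstHeavy≡firstᵇ k M I (allBits ℓ))) found))

    stale⇒firstHeavy≡[] : ∀ k M I → (∀ {q} → q ∈ allBits ℓ → fresh I q ≡ false) → firstHeavy k M I (allBits ℓ) ≡ []
    stale⇒firstHeavy≡[] k M I stale = trans (firstHeavy≡firstᵇ k M I (allBits ℓ))
      (all-false⇒firstᵇ≡[] (freshHeavy k M I) (allBits ℓ) (λ {q} q∈ → cong (_∧ heavy k M I q) (stale q∈)))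

    unknown : Info → ℕ
    unknown I = count (fresh I) (allBits ℓ)

    fresh-extend : ∀ I q a x → fresh (I ++ (q , a) ∷ []) x ≡ fresh I x ∧ not (eqBits x q)
    fresh-extend I q a x rewrite map-++ proj₁ I ((q , a) ∷ []) = split (QI I)
      where
      split : ∀ qs → not (anyB (eqBits x) (qs ++ q ∷ [])) ≡ not (anyB (eqBits x) qs) ∧ not (eqBits x q)
      split []        with eqBits x q
      ... | true  = refl
      ... | false = refl
      split (q′ ∷ qs) with eqBits x q′
      ... | true  = refl
      ... | false = split qs

    unknown-extend : ∀ I q a → fresh I q ≡ true → unknown (I ++ (q , a) ∷ []) < unknown I
    unknown-extend I q a q-fresh =
      count-mono-< (allBits ℓ) still-fresh (∈-allBits ℓ q) now-known q-fresh
      where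
      still-fresh : ∀ x → fresh (I ++ (q , a) ∷ []) x ≡ true → fresh I x ≡ true
      still-fresh x e = ∧-conicalˡ (fresh I x) _ (trans (sym (fresh-extend I q a x)) e)
      now-known : fresh (I ++ (q , a) ∷ []) q ≡ false
      now-known rewrite fresh-extend I q a q | eqBits-refl q = Data.Bool.Properties.∧-zeroʳ (fresh I q)

    -- Every round of Eve's loop learns a fresh query, so fuel for all unknown queries exhausts the heavy ones.
    loop-saturates : ∀ fuel k M H I → unknown I ≤ fuel → firstHeavy k M (loop fuel k M H I) (allBits ℓ) ≡ []
    loop-saturates zero k M H I unknown≤0 =
      stale⇒firstHeavy≡[] k M I (count≡0⇒ (fresh I) (allBits ℓ) (n≤0⇒n≡0 unknown≤0))
    loop-saturates (suc fuel) k M H I bound with firstHeavy k M I (allBits ℓ) in found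
    ... | []       = found
    ... | q ∷ rest = loop-saturates fuel k M H (I ++ (q , H q) ∷ [])
                       (≤-pred (≤-trans (unknown-extend I q (H q) (firstHeavy≡∷⇒fresh k M I found)) bound))

    unknown≤2^ℓ : ∀ I → unknown I ≤ 2 ^ ℓ
    unknown≤2^ℓ I = subst (unknown I ≤_) (length-allBits ℓ) (count-≤-length (fresh I) (allBits ℓ))

    eveI-saturated : ∀ k ω {q} → fresh (eveI k ω) q ≡ true → heavy k (transcript k ω) (eveI k ω) q ≡ false
    eveI-saturated k ω {q} q-fresh =
      subst (λ b → b ∧ heavy k (transcript k ω) (eveI k ω) q ≡ false) q-fresh
            (firstHeavy≡[]⇒ k (transcript k ω) (eveI k ω) (saturated k ω) q)
      where
      saturated : ∀ k ω → firstHeavy k (transcript k ω) (eveI k ω) (allBits ℓ) ≡ []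
      saturated zero    ω@(_ , _ , H) = loop-saturates (2 ^ ℓ) zero (transcript zero ω) H [] (unknown≤2^ℓ [])
      saturated (suc k) ω@(_ , _ , H) =
        loop-saturates (2 ^ ℓ) (suc k) (transcript (suc k) ω) H (eveI k ω) (unknown≤2^ℓ (eveI k ω))

    eveI-light : ∀ k ω {q} → fresh (eveI k ω) q ≡ true →
      ℕtoℚ (cntQ k (transcript k ω) (eveI k ω) q * n)
        Data.Rational.≤ ε Data.Rational.* ℕtoℚ (cntGood k (transcript k ω) (eveI k ω))
    eveI-light k ω {q} q-fresh =
      Data.Rational.Properties.≮⇒≥ (toWitnessFalse {a? = ε *ℚ ℕtoℚ good <ℚ? ℕtoℚ (asked * n)} not-heavy)
      where
      open Data.Rational using () renaming (_*_ to _*ℚ_)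
      open Data.Rational.Properties using () renaming (_<?_ to _<ℚ?_)
      good asked : ℕ
      good = cntGood k (transcript k ω) (eveI k ω)
      asked = cntQ k (transcript k ω) (eveI k ω) q
      not-heavy : T (not (heavy k (transcript k ω) (eveI k ω) q))
      not-heavy = subst (λ b → T (not b)) (sym (eveI-saturated k ω {q} q-fresh)) tt

module _ {ℓ tA tB mlen : ℕ} (P : Protocol ℓ tA tB mlen) where

  open import Data.Nat using (_≤_; _<_; _+_; _*_; suc; NonZero; >-nonZero)
  open import Data.Nat.Properties using (*-assoc; *-monoˡ-≤; module ≤-Reasoning)
  open import Data.Nat.Coprimality using (Coprime)
  open import Data.Integer using (+_)
  open import Data.Bool using (if_then_else_; _∧_)
  open import Data.Bool.Properties using (∧-conicalˡ)
  open import Data.Rational using (ℚ; 0ℚ; mkℚ) renaming (_<_ to _<ℚ_; _*_ to _*ℚ_)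
  open import Data.Rational.Solver using (module +-*-Solver)
  open import Function using (flip)
  open import Relation.Binary.PropositionalEquality
  open import Defs using (ℕtoℚ; sumℕ; sumℚ)
  open Model P
  open ProtocolFacts P
  open FiniteSums
  open NatArithmetic
  open RationalBridge

  module _ (n p d-1 : ℕ) .(c : Coprime p (suc d-1)) where

    open Eve n (mkℚ (+ p) d-1 c)
    open EveFacts n (mkℚ (+ p) d-1 c)
    open Fraction p d-1 c

    eveI-light-ℕ : ∀ k ω {q} → fresh (eveI k ω) q ≡ true →
      cntQ k (transcript k ω) (eveI k ω) q * (n * suc d-1) ≤ p * cntGood k (transcript k ω) (eveI k ω)
    eveI-light-ℕ k ω {q} q-fresh = subst (_≤ p * cntGood k (transcript k ω) (eveI k ω)) (*-assoc asked n (suc d-1))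
      (≤ε*⇒ (asked * n) (cntGood k (transcript k ω) (eveI k ω)) (eveI-light k ω {q} q-fresh))
      where
      asked : ℕ
      asked = cntQ k (transcript k ω) (eveI k ω) q

  module ViewGraph (k : ℕ) (M : Transcript) (I : Info) (𝒜 : ViewA → ℚ) (ℬ : ViewB → ℚ)
    (cL : ViewA → ℕ) (cR : ViewB → ℕ) (λL λR : ℚ) (0<λL : 0ℚ <ℚ λL) (0<λR : 0ℚ <ℚ λR)
    (cL≡λL𝒜 : ∀ a → a ∈ viewsA k → ℕtoℚ (cL a) ≡ λL *ℚ 𝒜 a)
    (cR≡λRℬ : ∀ b → b ∈ viewsB k → ℕtoℚ (cR b) ≡ λR *ℚ ℬ b)
    (0<Zgood : 0ℚ <ℚ Zgood k M I 𝒜 ℬ)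
    (GEXEC≡ : ∀ a b → a ∈ viewsA k → b ∈ viewsB k →
      ℕtoℚ (cntAB k M I a b) *ℚ Zgood k M I 𝒜 ℬ ≡ prodGood k M I 𝒜 ℬ a b *ℚ ℕtoℚ (cntGood k M I)) where

    module G  = ConflictGraph (viewsA k) (viewsB k) cL cR (Good k M I) (QA k M) (QB k M) (fresh I) asks ∈⇒asks
    module Gᵀ = ConflictGraph (viewsB k) (viewsA k) cR cL (flip (Good k M I)) (QB k M) (QA k M) (fresh I) asks ∈⇒asks

    edges≡λLλRZgood : ℕtoℚ G.edges ≡ λL *ℚ λR *ℚ Zgood k M I 𝒜 ℬ
    edges≡λLλRZgood = begin
      ℕtoℚ G.edges
        ≡⟨ ℕtoℚ-sumℕ (λ a → sumℕ (λ b → edge a b) (viewsB k)) (viewsA k) ⟩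
      sumℚ (λ a → ℕtoℚ (sumℕ (λ b → edge a b) (viewsB k))) (viewsA k)
        ≡⟨ sumℚ-cong {f = λ a → ℕtoℚ (sumℕ (edge a) (viewsB k))} (viewsA k) (λ a a∈ →
             trans (ℕtoℚ-sumℕ (edge a) (viewsB k))
                   (sumℚ-cong {f = λ b → ℕtoℚ (edge a b)} {g = λ b → λL *ℚ λR *ℚ prodGood k M I 𝒜 ℬ a b} (viewsB k)
                              (λ b b∈ → ℕtoℚ-if-* (Good k M I a b) (cL a) (cR b) λL λR (𝒜 a) (ℬ b)
                                                  (cL≡λL𝒜 a a∈) (cR≡λRℬ b b∈)))) ⟩
      sumℚ (λ a → sumℚ (λ b → λL *ℚ λR *ℚ prodGood k M I 𝒜 ℬ a b) (viewsB k)) (viewsA k)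
        ≡⟨ sumℚ-cong {g = λ a → λL *ℚ λR *ℚ sumℚ (prodGood k M I 𝒜 ℬ a) (viewsB k)} (viewsA k)
                     (λ a _ → sumℚ-*ˡ (λL *ℚ λR) (prodGood k M I 𝒜 ℬ a) (viewsB k)) ⟩
      sumℚ (λ a → λL *ℚ λR *ℚ sumℚ (prodGood k M I 𝒜 ℬ a) (viewsB k)) (viewsA k)
        ≡⟨ sumℚ-*ˡ (λL *ℚ λR) (λ a → sumℚ (prodGood k M I 𝒜 ℬ a) (viewsB k)) (viewsA k) ⟩
      λL *ℚ λR *ℚ Zgood k M I 𝒜 ℬ ∎
      where
      open ≡-Reasoning
      edge : ViewA → ViewB → ℕ
      edge a b = if Good k M I a b then cL a * cR b else 0

    edges>0 : 0 < G.edges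
    edges>0 = ℕtoℚ-pos edges≡λLλRZgood (positive-*-* 0<λL 0<λR 0<Zgood)

    edgesᵀ>0 : 0 < Gᵀ.edges
    edgesᵀ>0 = subst (0 <_) (sym G.edges-transpose) edges>0

    -- GEXEC(M, I) = (𝒜 × ℬ) | Good, rescaled to the copy counts.
    good-pair-count : ∀ a b → a ∈ viewsA k → b ∈ viewsB k → Good k M I a b ≡ true →
      cntAB k M I a b * G.edges ≡ cL a * cR b * cntGood k M I
    good-pair-count a b a∈ b∈ good = ℕtoℚ-injective (begin
      ℕtoℚ (cntAB k M I a b * G.edges)                 ≡⟨ ℕtoℚ-* (cntAB k M I a b) G.edges ⟩
      x *ℚ ℕtoℚ G.edges                                ≡⟨ cong (x *ℚ_) edges≡λLλRZgood ⟩
      x *ℚ (λL *ℚ λR *ℚ Z)                             ≡⟨ pull x λL λR Z ⟩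
      λL *ℚ λR *ℚ (x *ℚ Z)                             ≡⟨ cong (λL *ℚ λR *ℚ_) (GEXEC≡ a b a∈ b∈) ⟩
      λL *ℚ λR *ℚ (prodGood k M I 𝒜 ℬ a b *ℚ g)        ≡⟨ cong (λ t → λL *ℚ λR *ℚ ((if t then 𝒜 a *ℚ ℬ b else 0ℚ) *ℚ g)) good ⟩
      λL *ℚ λR *ℚ (𝒜 a *ℚ ℬ b *ℚ g)                    ≡⟨ spread λL λR (𝒜 a) (ℬ b) g ⟩
      λL *ℚ 𝒜 a *ℚ (λR *ℚ ℬ b) *ℚ g                    ≡⟨ cong₂ (λ u v → u *ℚ v *ℚ g) (cL≡λL𝒜 a a∈) (cR≡λRℬ b b∈) ⟨
      ℕtoℚ (cL a) *ℚ ℕtoℚ (cR b) *ℚ g                  ≡⟨ trans (ℕtoℚ-* (cL a * cR b) _) (cong (_*ℚ g) (ℕtoℚ-* (cL a) (cR b))) ⟨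
      ℕtoℚ (cL a * cR b * cntGood k M I)               ∎)
      where
      open ≡-Reasoning
      open +-*-Solver
      x g Z : ℚ
      x = ℕtoℚ (cntAB k M I a b)
      g = ℕtoℚ (cntGood k M I)
      Z = Zgood k M I 𝒜 ℬ
      pull : ∀ x l r z → x *ℚ (l *ℚ r *ℚ z) ≡ l *ℚ r *ℚ (x *ℚ z)
      pull = solve 4 (λ x l r z → x :* (l :* r :* z) := l :* r :* (x :* z)) refl
      spread : ∀ l r u v g → l *ℚ r *ℚ (u *ℚ v *ℚ g) ≡ l *ℚ u *ℚ (r *ℚ v) *ℚ g
      spread = solve 5 (λ l r u v g → l :* r :* (u :* v :* g) := l :* u :* (r :* v) :* g) refl

    edgesAsking*cntGood≤ : ∀ q → G.edgesAsking q * cntGood k M I ≤ cntQ k M I q * G.edges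
    edgesAsking*cntGood≤ q = begin
      G.edgesAsking q * g
        ≡⟨ sumℕ-*ʳ g (λ a → sumℕ (weight a) (viewsB k)) (viewsA k) ⟨
      sumℕ (λ a → sumℕ (weight a) (viewsB k) * g) (viewsA k)
        ≡⟨ sumℕ-cong (viewsA k) (λ a a∈ → reweigh-row a a∈) ⟩
      sumℕ (λ a → sumℕ (samples a) (viewsB k) * G.edges) (viewsA k)
        ≡⟨ sumℕ-*ʳ G.edges (λ a → sumℕ (samples a) (viewsB k)) (viewsA k) ⟩
      sumℕ (λ a → sumℕ (samples a) (viewsB k)) (viewsA k) * G.edges
        ≤⟨ *-monoˡ-≤ G.edges (askingPairs≤cntQ k M I q) ⟩
      cntQ k M I q * G.edges ∎
      where
      open ≤-Reasoning
      g : ℕ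
      g = cntGood k M I
      asking : ViewA → ViewB → Bool
      asking a b = Good k M I a b ∧ asksEither k M q a b
      weight : ViewA → ViewB → ℕ
      weight a b = if asking a b then cL a * cR b else 0
      samples : ViewA → ViewB → ℕ
      samples a b = if asking a b then cntAB k M I a b else 0
      transfer : ∀ (t : Bool) (w s e : ℕ) → (t ≡ true → s * e ≡ w * g) →
                 (if t then w else 0) * g ≡ (if t then s else 0) * e
      transfer true  w s e s*e≡w*g = sym (s*e≡w*g refl)
      transfer false w s e _       = refl
      reweigh-row : ∀ a → a ∈ viewsA k → sumℕ (weight a) (viewsB k) * g ≡ sumℕ (samples a) (viewsB k) * G.edges
      reweigh-row a a∈ = begin-equality
        sumℕ (weight a) (viewsB k) * g              ≡⟨ sumℕ-*ʳ g (weight a) (viewsB k) ⟨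
        sumℕ (λ b → weight a b * g) (viewsB k)      ≡⟨ sumℕ-cong (viewsB k) (λ b b∈ →
          transfer (asking a b) (cL a * cR b) (cntAB k M I a b) G.edges
                   (λ asked → good-pair-count a b a∈ b∈ (∧-conicalˡ (Good k M I a b) (asksEither k M q a b) asked))) ⟩
        sumℕ (λ b → samples a b * G.edges) (viewsB k) ≡⟨ sumℕ-*ʳ G.edges (samples a) (viewsB k) ⟩
        sumℕ (samples a) (viewsB k) * G.edges       ∎

    light-transfer : ∀ n p d → 0 < cntGood k M I →
      (∀ q → fresh I q ≡ true → cntQ k M I q * (n * d) ≤ p * cntGood k M I) → G.Light n p d
    light-transfer n p d cntGood>0 cntQ-light q q-fresh =
      ratio-≤-trans {G.edgesAsking q} {G.edges} {cntQ k M I q} {cntGood k M I} {n * d} {p} {{>-nonZero cntGood>0}}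
        (edgesAsking*cntGood≤ q) (cntQ-light q q-fresh)

    sizeR-split : ∀ a → sizeR k cR ≡ degL k M I cR a + G.nonDegX a
    sizeR-split a = trans (G.sizeY-split a) (cong (_+ G.nonDegX a) (sumℕ-cong
      {f = λ b → if Good k M I a b then cR b else 0} {g = λ b → if Edge k M I a b then cR b else 0} (viewsB k)
      (λ b _ → cong (λ t → if t then cR b else 0) (sym (Edge≡Good k M I a b)))))

    sizeL-split : ∀ b → sizeL k cL ≡ degR k M I cL b + Gᵀ.nonDegX b
    sizeL-split b = trans (Gᵀ.sizeY-split b) (cong (_+ Gᵀ.nonDegX b) (sumℕ-cong
      {f = λ a → if Good k M I a b then cL a else 0} {g = λ a → if Edge k M I a b then cL a else 0} (viewsA k)
      (λ a _ → cong (λ t → if t then cL a else 0) (sym (Edge≡Good k M I a b)))))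

open import Defs
open import Data.Nat using (ℕ; _<_; _*_)
open import Data.Product using (_×_)
open import Data.Integer using (+_)
open import Data.Rational using (ℚ; 0ℚ; 1ℚ; _/_; _-_; _≤_) renaming (_<_ to _<ℚ_; _*_ to _*ℚ_)
open import Data.List.Membership.Propositional using (_∈_)
open import Relation.Binary.PropositionalEquality using (_≡_)

open import Data.Nat using (suc; NonZero)
import Data.Nat
open import Data.List using (length)
open import Data.Integer using (-[1+_])
open import Data.Rational using (mkℚ)
open import Data.Product using (_,_)
open import Data.Empty using (⊥-elim)
open NatArithmetic
open RationalBridge

lemma4p5 : ∀ {ℓ tA tB mlen : ℕ} (P : Protocol ℓ tA tB mlen) (n : ℕ) (ε : ℚ) →
    0ℚ <ℚ ε → ε <ℚ (+ 1 / 10) →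
    Model.NoRepeat P n →
    (k : ℕ) → k < 2 * n →
    (ω₀ : Model.Ω P) →
    let open Model P
        open Eve n ε
        M = transcript k ω₀
        I = eveI k ω₀
    in 0 < cntGood k M I →
    (𝒜 : ViewA → ℚ) (ℬ : ViewB → ℚ) →
    (∀ a → a ∈ viewsA k → 0ℚ ≤ 𝒜 a) → (∀ b → b ∈ viewsB k → 0ℚ ≤ ℬ b) →
    sumℚ 𝒜 (viewsA k) ≡ 1ℚ → sumℚ ℬ (viewsB k) ≡ 1ℚ →
    0ℚ <ℚ Zgood k M I 𝒜 ℬ →
    (∀ a b → a ∈ viewsA k → b ∈ viewsB k →
      ℕtoℚ (cntAB k M I a b) *ℚ Zgood k M I 𝒜 ℬ
        ≡ prodGood k M I 𝒜 ℬ a b *ℚ ℕtoℚ (cntGood k M I)) →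
    (cL : ViewA → ℕ) (cR : ViewB → ℕ) (λL λR : ℚ) → 0ℚ <ℚ λL → 0ℚ <ℚ λR →
    (∀ a → a ∈ viewsA k → ℕtoℚ (cL a) ≡ λL *ℚ 𝒜 a) →
    (∀ b → b ∈ viewsB k → ℕtoℚ (cR b) ≡ λR *ℚ ℬ b) →
    (∀ a → a ∈ viewsA k → 0 < cL a →
      (1ℚ - ℕtoℚ 2 *ℚ ε) *ℚ ℕtoℚ (sizeR k cR) ≤ ℕtoℚ (degL k M I cR a)) ×
    (∀ b → b ∈ viewsB k → 0 < cR b →
      (1ℚ - ℕtoℚ 2 *ℚ ε) *ℚ ℕtoℚ (sizeL k cL) ≤ ℕtoℚ (degR k M I cL b))
lemma4p5 P n (mkℚ -[1+ _ ] _ _) 0<ε _ = ⊥-elim (¬0<negative 0<ε)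
lemma4p5 P n (mkℚ (+ p) d-1 c) _ ε<1/10 _ k k<2n ω₀ cntGood>0 𝒜 ℬ _ _ _ _ 0<Zgood GEXEC≡
         cL cR λL λR 0<λL 0<λR cL≡λL𝒜 cR≡λRℬ =
    (λ a _ _ → fraction-bound _ _ _ (sizeR-split a)
                 (G.nonDegX-bound n p d 2p≤d conflicts light |QA|≤n |QB|≤n edges>0 a))
  , (λ b _ _ → fraction-bound _ _ _ (sizeL-split b)
                 (Gᵀ.nonDegX-bound n p d 2p≤d (G.conflicts-transpose conflicts) (G.light-transpose {n} {p} {d} light)
                                   |QB|≤n |QA|≤n edgesᵀ>0 b))
  where
  open Model P
  open ProtocolFacts P
  open Fraction p d-1 c
  M : Transcript
  M = transcript k ω₀
  I : Info
  I = Eve.eveI n (mkℚ (+ p) d-1 c) k ω₀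
  open ViewGraph P k M I 𝒜 ℬ cL cR λL λR 0<λL 0<λR cL≡λL𝒜 cR≡λRℬ 0<Zgood GEXEC≡
  d : ℕ
  d = suc d-1
  instance
    n≢0 : NonZero n
    n≢0 = <2*⇒nonZero k<2n
  2p≤d : 2 * p Data.Nat.≤ d
  2p≤d = ε<1/10⇒2p≤d ε<1/10
  |QA|≤n : ∀ a → length (QA k M a) Data.Nat.≤ n
  |QA|≤n a = QA-length M a k<2n
  |QB|≤n : ∀ b → length (QB k M b) Data.Nat.≤ n
  |QB|≤n b = QB-length M b k<2n
  conflicts : G.Conflicts
  conflicts = ¬Good⇒sharedFresh k M I
  light : G.Light n p d
  light = light-transfer n p d cntGood>0 (λ q → eveI-light-ℕ P n p d-1 c k ω₀ {q})
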